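{- (1) The vertices of $B(v_{\Lambda_n^B}\otimes0)$ are exactly the words $\mathfrak Cx$ with $\mathfrak C$ a spin column and $x\in\mathcal B_n$ such that $x\vartriangle\mathfrak C$. (2) The vertices of $B(v_{\Lambda_n^B}\otimes1)$ are exactly the words $\mathfrak Cx$ with $\mathfrak C$ a spin column and $x\in\mathcal B_n$ such that $x\not\vartriangle\mathfrak C$. (3) Let $\Psi:B(v_{\Lambda_n^B}\otimes0)\to B(v_{\Lambda_n^B})$ and $\Psi':B(v_{\Lambda_n^B}\otimes1)\to B(1\otimes v_{\Lambda_n^B})$ be the crystal isomorphisms. If $x\vartriangle\mathfrak C$ then $\Psi(\mathfrak Cx)=\mathfrak C'$ where $\mathfrak C'$ is the spin column with $\mathrm{wt}(\mathfrak C')=\mathrm{wt}(\mathfrak C)+\mathrm{wt}(x)$. If $x\not\vartriangle\mathfrak C$ then $\Psi'(\mathfrak Cx)=x'\mathfrak C'$, where $x'=\min\{t\in\mathfrak C:t\succeq x\}$ if $x\succeq0$, $x'=\min(\{t\in\mathfrak C:t\succeq x\}\cup\{0\})$ if $x\preceq n$, and $\mathfrak C'$ is the spin column with $\mathrm{wt}(\mathfrak C')=\mathrm{wt}(\mathfrak C)+\mathrm{wt}(x)-\mathrm{wt}(x')$.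
   Context: Crystal conventions: $\varepsilon_i,\varphi_i$ as usual, $\mathrm{wt}(u)=\sum_i(\varphi_i(u)-\varepsilon_i(u))\Lambda_i$; tensor rule $\tilde f_i(u\otimes v)=\tilde f_i(u)\otimes v$ if $\varphi_i(u)>\varepsilon_i(v)$, else $u\otimes\tilde f_i(v)$; $\tilde e_i(u\otimes v)=u\otimes\tilde e_i(v)$ if $\varphi_i(u)<\varepsilon_i(v)$, else $\tilde e_i(u)\otimes v$. Type $B$ ($U_q(so_{2n+1})$, node $n$ short): $\mathcal B_n=\{1\prec\cdots\prec n\prec0\prec\bar n\prec\cdots\prec\bar 1\}$; vector crystal $i\xrightarrow{i}i+1$, $\overline{i+1}\xrightarrow{i}\bar i$ ($i\le n-1$), $n\xrightarrow{n}0\xrightarrow{n}\bar n$. Spin columns: sets containing, for each $k\le n$, exactly one of $k,\bar k$; $B(v_{\Lambda_n^B})$ is the crystal of spin columns with $\tilde f_n$ replacing $n$ by $\bar n$ (if $n\in\mathfrak C$, else $0$), $\tilde e_n$ the reverse, and for $i<n$, $\tilde f_i$ replacing $i,\overline{i+1}$ by $i+1,\bar i$ (if both present, else $0$), $\tilde e_i$ the reverse. A spin column is determined by its weight. $v_{\Lambda_n^B}=\{1,\dots,n\}$. $\mathfrak G_n^B$ is the crystal of all words on the generalized letters (letters of $\mathcal B_n$ and spin columns), a word being the tensor product of its letters. $B(v_{\Lambda_n^B}\otimes0)$, $B(v_{\Lambda_n^B}\otimes 1)$, $B(1\otimes v_{\Lambda_n^B})$ denote the connected components of $\mathfrak G_n^B$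 containing these words. For $x\in\mathcal B_n$ and a spin column $\mathfrak C$ with greatest letter $z$ (in the order of $\mathcal B_n$), $x\vartriangle\mathfrak C$ means $x\not\preceq z$. -}

module Defs where

-- Crystals of type B_n  (U_q(so_{2n+1}), node n short).
-- Nodes of the Dynkin diagram 1..n are represented by  i : Fin n  (node toℕ i + 1).

open import Data.Nat using (ℕ; zero; suc; _+_; _∸_; _≤_; _<_; _<ᵇ_; _*_)
open import Data.Fin using (Fin; zero; suc; toℕ)
import Data.Fin as F
open import Data.Bool using (Bool; true; false; if_then_else_; _∧_)
open import Data.Vec using (Vec; lookup; _[_]≔_; replicate)
import Data.Vec.Properties as VP
open import Data.Maybe using (Maybe; just; nothing)
import Data.Maybe as M
open import Data.List using (List; []; _∷_)
open import Data.Integer using (ℤ; +_; _-_)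
open import Data.Product using (Σ; _×_; _,_; ∃)
open import Data.Sum using (_⊎_)
open import Relation.Nullary using (¬_; yes; no)
open import Relation.Nullary.Decidable using (⌊_⌋)
open import Relation.Binary.PropositionalEquality using (_≡_)

succF : ∀ {n} → Fin n → Maybe (Fin n)
succF {suc zero}    zero    = nothing
succF {suc (suc m)} zero    = just (suc zero)
succF {suc (suc m)} (suc i) = M.map suc (succF i)

_=F_ : ∀ {n} → Fin n → Fin n → Bool
i =F j = ⌊ i F.≟ j ⌋

-- The alphabet  B_n = {1 ≺ ... ≺ n ≺ 0 ≺ n̄ ≺ ... ≺ 1̄}.
--   pos k  is the letter  k+1,   neg k  is the letter  \overline{k+1},
--   zer    is the letter  0.

data Letter (n : ℕ) : Set where
  pos : Fin n → Letter n
  zer : Letter n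
  neg : Fin n → Letter n

rank : ∀ {n} → Letter n → ℕ
rank     (pos k) = toℕ k
rank {n} zer     = n
rank {n} (neg k) = n + (n ∸ toℕ k)

_⪯_ : ∀ {n} → Letter n → Letter n → Set
x ⪯ y = rank x ≤ rank y

_≺_ : ∀ {n} → Letter n → Letter n → Set
x ≺ y = rank x < rank y

fLet : ∀ {n} → Fin n → Letter n → Maybe (Letter n)
fLet i (pos k) with succF i
... | just j  = if k =F i then just (pos j) else nothing
... | nothing = if k =F i then just zer else nothing
fLet i zer with succF i
... | just j  = nothing
... | nothing = just (neg i)
fLet i (neg k) with succF i
... | just j  = if k =F j then just (neg i) else nothing
... | nothing = nothing

eLet : ∀ {n} → Fin n → Letter n → Maybe (Letter n)
eLet i (pos k) with succF i
... | just j  = if k =F j then just (pos i) else nothing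
... | nothing = nothing
eLet i zer with succF i
... | just j  = nothing
... | nothing = just (pos i)
eLet i (neg k) with succF i
... | just j  = if k =F i then just (neg j) else nothing
... | nothing = if k =F i then just zer else nothing

-- Spin columns: a column contains, for each k, exactly one of k, k̄.
-- Encoded as  Vec Bool n :  entry k is true iff (k+1) ∈ C (else \overline{k+1} ∈ C).

SpinCol : ℕ → Set
SpinCol n = Vec Bool n

_∈C_ : ∀ {n} → Letter n → SpinCol n → Set
pos k ∈C C = lookup C k ≡ true
zer   ∈C C = Data.Empty.⊥ where import Data.Empty
neg k ∈C C = lookup C k ≡ false

topCol : ∀ n → SpinCol n
topCol n = replicate n true

fCol : ∀ {n} → Fin n → SpinCol n → Maybe (SpinCol n)
fCol i C with succF i
... | just j  = if lookup C i ∧ Data.Bool.not (lookup C j)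
                  then just ((C [ i ]≔ false) [ j ]≔ true) else nothing
  where import Data.Bool
... | nothing = if lookup C i then just (C [ i ]≔ false) else nothing

eCol : ∀ {n} → Fin n → SpinCol n → Maybe (SpinCol n)
eCol i C with succF i
... | just j  = if Data.Bool.not (lookup C i) ∧ lookup C j
                  then just ((C [ i ]≔ true) [ j ]≔ false) else nothing
  where import Data.Bool
... | nothing = if lookup C i then nothing else just (C [ i ]≔ true)

data GLetter (n : ℕ) : Set where
  letter : Letter n → GLetter n
  col    : SpinCol n → GLetter n

fG : ∀ {n} → Fin n → GLetter n → Maybe (GLetter n)
fG i (letter x) = M.map letter (fLet i x)
fG i (col C)    = M.map col (fCol i C)

eG : ∀ {n} → Fin n → GLetter n → Maybe (GLetter n)
eG i (letter x) = M.map letter (eLet i x)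
eG i (col C)    = M.map col (eCol i C)

strLen : ∀ {A : Set} → ℕ → (A → Maybe A) → A → ℕ
strLen zero    g b = 0
strLen (suc k) g b with g b
... | nothing = 0
... | just b' = suc (strLen k g b')

-- ε_i(b) = max{k : ẽ_i^k b ≠ 0},  φ_i(b) = max{k : f̃_i^k b ≠ 0}.
-- (All i-strings in these crystals have length ≤ 2, so fuel 3 suffices.)
εG : ∀ {n} → Fin n → GLetter n → ℕ
εG i = strLen 3 (eG i)

φG : ∀ {n} → Fin n → GLetter n → ℕ
φG i = strLen 3 (fG i)

wtG : ∀ {n} → GLetter n → Fin n → ℤ
wtG u i = + φG i u - + εG i u

Word : ℕ → Set
Word n = List (GLetter n)

-- A word a₁a₂…a_k is the tensor product a₁ ⊗ (a₂ ⊗ (… ⊗ a_k)).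
-- ε, φ of a tensor product (standard formulas for the given tensor rule).
εW : ∀ {n} → Fin n → Word n → ℕ
φW : ∀ {n} → Fin n → Word n → ℕ
εW i []      = 0
εW i (a ∷ w) = εG i a + (εW i w ∸ φG i a)
φW i []      = 0
φW i (a ∷ w) = φW i w + (φG i a ∸ εW i w)

fW : ∀ {n} → Fin n → Word n → Maybe (Word n)
fW i []      = nothing
fW i (a ∷ w) = if εW i w <ᵇ φG i a
                 then M.map (_∷ w) (fG i a)
                 else M.map (a ∷_) (fW i w)

eW : ∀ {n} → Fin n → Word n → Maybe (Word n)
eW i []      = nothing
eW i (a ∷ w) = if φG i a <ᵇ εW i w
                 then M.map (a ∷_) (eW i w)
                 else M.map (_∷ w) (eG i a)

data _∼_ {n : ℕ} (w₀ : Word n) : Word n → Set where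
  here  : w₀ ∼ w₀
  fstep : ∀ {u v} (i : Fin n) → w₀ ∼ u → fW i u ≡ just v → w₀ ∼ v
  estep : ∀ {u v} (i : Fin n) → w₀ ∼ u → eW i u ≡ just v → w₀ ∼ v

record CrystalIso {n : ℕ} (a b : Word n) (Ψ : Word n → Word n) : Set where
  field
    into   : ∀ w → a ∼ w → b ∼ Ψ w
    inj    : ∀ w w' → a ∼ w → a ∼ w' → Ψ w ≡ Ψ w' → w ≡ w'
    surj   : ∀ v → b ∼ v → Σ (Word n) λ w → a ∼ w × Ψ w ≡ v
    f-comm : ∀ i w → a ∼ w → fW i (Ψ w) ≡ M.map Ψ (fW i w)
    e-comm : ∀ i w → a ∼ w → eW i (Ψ w) ≡ M.map Ψ (eW i w)
    ε-pres : ∀ i w → a ∼ w → εW i (Ψ w) ≡ εW i w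
    φ-pres : ∀ i w → a ∼ w → φW i (Ψ w) ≡ φW i w

IsGreatest : ∀ {n} → SpinCol n → Letter n → Set
IsGreatest C z = z ∈C C × (∀ t → t ∈C C → t ⪯ z)

_▵_ : ∀ {n} → Letter n → SpinCol n → Set
x ▵ C = ∃ λ z → IsGreatest C z × ¬ (x ⪯ z)

-- The set from which x' is chosen:
--   {t ∈ 𝔆 : t ⪰ x}           if x ⪰ 0,
--   {t ∈ 𝔆 : t ⪰ x} ∪ {0}     if x ⪯ n  (i.e. x ≺ 0).
PrimeCand : ∀ {n} → SpinCol n → Letter n → Letter n → Set
PrimeCand C x t = (t ∈C C × x ⪯ t) ⊎ (x ≺ zer × t ≡ zer)

IsMin : ∀ {n} → (Letter n → Set) → Letter n → Set
IsMin S m = S m × (∀ t → S t → m ⪯ t)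

w-v0 : ∀ n → Word n
w-v0 n = col (topCol n) ∷ letter zer ∷ []

w-v1 : ∀ n → {{_ : Data.Nat.NonZero n}} → Word n
w-v1 (suc n) = col (topCol (suc n)) ∷ letter (pos zero) ∷ []

w-v : ∀ n → Word n
w-v n = col (topCol n) ∷ []

w-1v : ∀ n → {{_ : Data.Nat.NonZero n}} → Word n
w-1v (suc n) = letter (pos zero) ∷ col (topCol (suc n)) ∷ []

{-# OPTIONS --safe #-}

-- Both components consist of two-letter words 𝔆x, on which f̃ᵢ and ẽᵢ act by the tensor
-- rule through 𝔆 or through x.  Read off the entries of 𝔆, x ▵ 𝔆 says that x = 0 and
-- 𝔆 = {1,…,n}, or x = k̄ and 1,…,k ∈ 𝔆; a case check shows that every such step preserves
-- this condition in both directions, so it is constant on components.  Conversely every word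
-- other than v⊗0 and v⊗1 is f̃ᵢ of a word of smaller height: take i to be the last index with
-- ī ∈ 𝔆, or read i off x when 𝔆 = {1,…,n}.  Crystal isomorphisms
-- preserve weights and B(v) consists of single columns, which gives Ψ.  For Ψ′ one checks,
-- case by case, that along each of these descent steps f̃ᵢ carries x′𝔆′ (𝔆′ is 𝔆 with x′
-- traded for x) to the corresponding word one step up; since Ψ′ commutes with f̃ᵢ and sends
-- v⊗1 to 1⊗v, induction on the height gives Ψ′(𝔆x) = x′𝔆′.

module Submission where

open import Defs
open import Data.Bool using (Bool; true; false; if_then_else_)
open import Data.Empty using (⊥; ⊥-elim)
open import Data.Fin as Fin using (Fin; zero; suc; toℕ)
open import Data.Fin.Properties using (toℕ-injective; toℕ<n; toℕ-fromℕ)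
open import Data.Integer using (ℤ; +_; _+_; _-_)
import Data.Integer.Properties as ℤ
open import Data.Integer.Tactic.RingSolver using (solve-∀)
open import Data.List using ([]; _∷_)
open import Data.Maybe as Maybe using (Maybe; just; nothing)
open import Data.Maybe.Properties using (just-injective)
open import Data.Nat as ℕ using (ℕ; zero; suc; _∸_; _≤_; _<_; _<ᵇ_; z≤n; s≤s; NonZero)
import Data.Nat.Properties as ℕ
open import Data.Nat.Induction using (<-wellFounded)
open import Data.Product using (_×_; _,_; ∃; ∃₂; proj₁; proj₂)
open import Data.Sum using (_⊎_; inj₁; inj₂)
open import Data.Vec using (Vec; []; _∷_; lookup; _[_]≔_)
import Data.Vec.Properties as Vecₚ
open import Function using (_∘_; case_of_)
open import Induction.WellFounded using (Acc; acc)
open import Relation.Binary using (tri<; tri≈; tri>)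
open import Relation.Binary.PropositionalEquality
open import Relation.Nullary using (¬_; yes; no)

private
  variable
    n : ℕ
    i j k : Fin n

true≢false : ∀ {b} → b ≡ true → b ≢ false
true≢false refl ()

<⇒≢ : ∀ {k l : Fin n} → toℕ k < toℕ l → k ≢ l
<⇒≢ k<l refl = ℕ.<-irrefl refl k<l

>⇒≢ : ∀ {k l : Fin n} → toℕ k < toℕ l → l ≢ k
>⇒≢ = ≢-sym ∘ <⇒≢

<ᵇ-true : ∀ {m k} → m < k → (m <ᵇ k) ≡ true
<ᵇ-true {m} {k} m<k with m <ᵇ k | ℕ.<⇒<ᵇ m<k
... | true | _ = refl

<ᵇ-false : ∀ {m k} → k ≤ m → (m <ᵇ k) ≡ false
<ᵇ-false {m} {k} k≤m with m <ᵇ k | ℕ.<ᵇ⇒< m k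
... | false | _    = refl
... | true  | m<k = ⊥-elim (ℕ.<⇒≱ (m<k _) k≤m)

map-just⁻ : ∀ {A B : Set} {g : A → B} (m : Maybe A) {b} → Maybe.map g m ≡ just b →
            ∃ λ a → m ≡ just a × g a ≡ b
map-just⁻ (just a) refl = a , refl , refl

module _ {a} {A : Set a} {n : ℕ} where

  []≔-id-local : ∀ (xs : Vec A n) i {x} → lookup xs i ≡ x → xs [ i ]≔ x ≡ xs
  []≔-id-local xs i eq = Vecₚ.updateAt-id-local i xs (sym eq)

  []≔-revert : ∀ (xs : Vec A n) i {x y} → lookup xs i ≡ x → xs [ i ]≔ y [ i ]≔ x ≡ xs
  []≔-revert xs i eq = trans (Vecₚ.[]≔-idempotent xs i) ([]≔-id-local xs i eq)

  []≔²-revert : ∀ (xs : Vec A n) {i j} {x y x′ y′} → i ≢ j → lookup xs i ≡ x → lookup xs j ≡ y →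
                xs [ i ]≔ x′ [ j ]≔ y′ [ i ]≔ x [ j ]≔ y ≡ xs
  []≔²-revert xs {i} {j} {x} {y} {x′} {y′} i≢j xi yj = begin
    xs [ i ]≔ x′ [ j ]≔ y′ [ i ]≔ x [ j ]≔ y
      ≡⟨ cong (_[ j ]≔ y) (Vecₚ.[]≔-commutes (xs [ i ]≔ x′) j i (≢-sym i≢j)) ⟩
    xs [ i ]≔ x′ [ i ]≔ x [ j ]≔ y′ [ j ]≔ y
      ≡⟨ cong (λ v → v [ j ]≔ y′ [ j ]≔ y) ([]≔-revert xs i xi) ⟩
    xs [ j ]≔ y′ [ j ]≔ y
      ≡⟨ []≔-revert xs j yj ⟩
    xs ∎
    where open ≡-Reasoning

  lookup∘update²′ : ∀ (xs : Vec A n) {i j l} {x y} → l ≢ i → l ≢ j →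
                    lookup (xs [ i ]≔ x [ j ]≔ y) l ≡ lookup xs l
  lookup∘update²′ xs {i} {x = x} {y} l≢i l≢j =
    trans (Vecₚ.lookup∘update′ l≢j (xs [ i ]≔ x) y) (Vecₚ.lookup∘update′ l≢i xs x)

  lookup∘update²-first : ∀ (xs : Vec A n) {i j} {x y} → i ≢ j → lookup (xs [ i ]≔ x [ j ]≔ y) i ≡ x
  lookup∘update²-first xs {i} {x = x} {y} i≢j =
    trans (Vecₚ.lookup∘update′ i≢j (xs [ i ]≔ x) y) (Vecₚ.lookup∘update i xs x)

  []≔²-commutes-[]≔ : ∀ (xs : Vec A n) {i j k} {x y z} → k ≢ i → k ≢ j →
                      xs [ i ]≔ x [ j ]≔ y [ k ]≔ z ≡ xs [ k ]≔ z [ i ]≔ x [ j ]≔ y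
  []≔²-commutes-[]≔ xs {i} {j} {k} {x} {y} {z} k≢i k≢j =
    trans (Vecₚ.[]≔-commutes (xs [ i ]≔ x) j k (≢-sym k≢j))
          (cong (_[ j ]≔ y) (Vecₚ.[]≔-commutes xs i k (≢-sym k≢i)))

  []≔²-commutes : ∀ (xs : Vec A n) {i j k l} {x y z w} → k ≢ i → k ≢ j → l ≢ i → l ≢ j →
                  xs [ i ]≔ x [ j ]≔ y [ k ]≔ z [ l ]≔ w ≡ xs [ k ]≔ z [ l ]≔ w [ i ]≔ x [ j ]≔ y
  []≔²-commutes xs {l = l} {w = w} k≢i k≢j l≢i l≢j =
    trans (cong (_[ l ]≔ w) ([]≔²-commutes-[]≔ xs k≢i k≢j)) ([]≔²-commutes-[]≔ _ l≢i l≢j)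

succF-toℕ : ∀ {n} (i : Fin n) {j} → succF i ≡ just j → toℕ j ≡ suc (toℕ i)
succF-toℕ {suc (suc _)} zero    refl = refl
succF-toℕ {suc (suc _)} (suc i) eq with succF i in e
succF-toℕ {suc (suc _)} (suc i) refl | just _ = cong suc (succF-toℕ i e)

succF-nothing-toℕ : ∀ {n} (i : Fin n) → succF i ≡ nothing → suc (toℕ i) ≡ n
succF-nothing-toℕ {suc zero}    zero    _  = refl
succF-nothing-toℕ {suc (suc _)} (suc i) eq with succF i in e
succF-nothing-toℕ {suc (suc _)} (suc i) refl | nothing = cong suc (succF-nothing-toℕ i e)

succF-< : ∀ (i : Fin n) {j} → succF i ≡ just j → toℕ i < toℕ j
succF-< i e = subst (toℕ i <_) (sym (succF-toℕ i e)) (ℕ.n<1+n _)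

succF-irrefl : (i : Fin n) → succF i ≢ just i
succF-irrefl i e = ℕ.<-irrefl refl (succF-< i e)

succF-≢ : ∀ (i : Fin n) {j} → succF i ≡ just j → i ≢ j
succF-≢ i e refl = succF-irrefl i e

succF-nothing≢just : succF i ≡ nothing → succF i ≢ just j
succF-nothing≢just e e′ = case trans (sym e) e′ of λ ()

data Node (i : Fin n) : Set where
  inner : ∀ j → succF i ≡ just j → Node i
  last  : succF i ≡ nothing → Node i

node : (i : Fin n) → Node i
node i with succF i in e
... | just j  = inner j e
... | nothing = last e

predecessor : ∀ {m} (j : Fin (suc m)) → j ≡ zero ⊎ ∃ λ i → succF i ≡ just j
predecessor zero = inj₁ refl
predecessor {suc m} (suc j) with predecessor j
... | inj₁ refl       = inj₂ (zero , refl)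
... | inj₂ (i , succ) = inj₂ (suc i , cong (Maybe.map suc) succ)

no-between : ∀ (k : Fin n) {j} → succF k ≡ just j →
             ∀ (l : Fin n) → toℕ k < toℕ l → toℕ l < toℕ j → ⊥
no-between k e l k<l l<j = ℕ.<⇒≱ k<l (ℕ.≤-pred (subst (toℕ l <_) (succF-toℕ k e) l<j))

last-≤ : ∀ (i : Fin n) → succF i ≡ nothing → ∀ l → toℕ l ≤ toℕ i
last-≤ i e l = ℕ.≤-pred (subst (toℕ l <_) (sym (succF-nothing-toℕ i e)) (toℕ<n l))

inner-≤ : ∀ (i : Fin n) {j} → succF i ≡ just j → ∀ l → toℕ l ≤ toℕ j → l ≢ j → toℕ l ≤ toℕ i
inner-≤ i e l l≤j l≢j =
  ℕ.≤-pred (subst (toℕ l <_) (succF-toℕ i e) (ℕ.≤∧≢⇒< l≤j (l≢j ∘ toℕ-injective)))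

-- The vector crystal

=F-refl : (i : Fin n) → (i =F i) ≡ true
=F-refl i with i Fin.≟ i
... | yes _  = refl
... | no i≢i = ⊥-elim (i≢i refl)

infix 4 _─[_]→_

data _─[_]→_ {n} : Letter n → Fin n → Letter n → Set where
  pos→pos : succF i ≡ just j  → pos i ─[ i ]→ pos j
  neg→neg : succF i ≡ just j  → neg j ─[ i ]→ neg i
  pos→zer : succF i ≡ nothing → pos i ─[ i ]→ zer
  zer→neg : succF i ≡ nothing → zer ─[ i ]→ neg i

fLet-arrow : ∀ (i : Fin n) x {y} → fLet i x ≡ just y → x ─[ i ]→ y
fLet-arrow i (pos k) f with succF i in e
... | just _ with k Fin.≟ i
fLet-arrow i (pos k) refl | just _ | yes refl = pos→pos e
fLet-arrow i (pos k) ()   | just _ | no _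
fLet-arrow i (pos k) f | nothing with k Fin.≟ i
fLet-arrow i (pos k) refl | nothing | yes refl = pos→zer e
fLet-arrow i (pos k) ()   | nothing | no _
fLet-arrow i zer f with succF i in e
fLet-arrow i zer refl | nothing = zer→neg e
fLet-arrow i (neg k) f with succF i in e
fLet-arrow i (neg k) () | nothing
... | just j with k Fin.≟ j
fLet-arrow i (neg k) refl | just j | yes refl = neg→neg e
fLet-arrow i (neg k) ()   | just j | no _

eLet-arrow : ∀ (i : Fin n) y {x} → eLet i y ≡ just x → x ─[ i ]→ y
eLet-arrow i (pos k) f with succF i in e
eLet-arrow i (pos k) () | nothing
... | just j with k Fin.≟ j
eLet-arrow i (pos k) refl | just j | yes refl = pos→pos e
eLet-arrow i (pos k) ()   | just j | no _
eLet-arrow i zer f with succF i in e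
eLet-arrow i zer refl | nothing = pos→zer e
eLet-arrow i (neg k) f with succF i in e
... | just _ with k Fin.≟ i
eLet-arrow i (neg k) refl | just _ | yes refl = neg→neg e
eLet-arrow i (neg k) ()   | just _ | no _
eLet-arrow i (neg k) f | nothing with k Fin.≟ i
eLet-arrow i (neg k) refl | nothing | yes refl = zer→neg e
eLet-arrow i (neg k) ()   | nothing | no _

arrow-fLet : ∀ {x y} → x ─[ i ]→ y → fLet i x ≡ just y
arrow-fLet (pos→pos {i = i} e) rewrite e | =F-refl i = refl
arrow-fLet (neg→neg {j = j} e) rewrite e | =F-refl j = refl
arrow-fLet (pos→zer {i = i} e) rewrite e | =F-refl i = refl
arrow-fLet (zer→neg e)         rewrite e = refl

arrow-eLet : ∀ {x y} → x ─[ i ]→ y → eLet i y ≡ just x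
arrow-eLet (pos→pos {j = j} e) rewrite e | =F-refl j = refl
arrow-eLet (neg→neg {i = i} e) rewrite e | =F-refl i = refl
arrow-eLet (pos→zer e)         rewrite e = refl
arrow-eLet (zer→neg {i = i} e) rewrite e | =F-refl i = refl

rank-neg-< : (k l : Fin n) → toℕ k < toℕ l → rank (neg l) < rank (neg k)
rank-neg-< {n} k l k<l = ℕ.+-monoʳ-< n (ℕ.∸-monoʳ-< k<l (ℕ.<⇒≤ (toℕ<n l)))

rank-zer<neg : (k : Fin n) → rank zer < rank (neg k)
rank-zer<neg {n} k =
  subst (_< n ℕ.+ (n ∸ toℕ k)) (ℕ.+-identityʳ n) (ℕ.+-monoʳ-< n (ℕ.m<n⇒0<n∸m (toℕ<n k)))

rank-neg-≤ : (k l : Fin n) → toℕ k ≤ toℕ l → rank (neg l) ≤ rank (neg k)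
rank-neg-≤ {n} k l k≤l = ℕ.+-monoʳ-≤ n (ℕ.∸-monoʳ-≤ n k≤l)

rank-neg-≤⁻ : (k l : Fin n) → rank (neg l) ≤ rank (neg k) → toℕ k ≤ toℕ l
rank-neg-≤⁻ {n} k l le = ℕ.∸-cancelʳ-≤ (ℕ.<⇒≤ (toℕ<n k)) (ℕ.+-cancelˡ-≤ n _ _ le)

rank-pos<neg : (k l : Fin n) → rank (pos k) < rank (neg l)
rank-pos<neg k l = ℕ.<-trans (toℕ<n k) (rank-zer<neg l)

arrow-rank : ∀ {x y} → x ─[ i ]→ y → rank x < rank y
arrow-rank (pos→pos {i = i} e) = succF-< i e
arrow-rank (neg→neg {i = i} e) = rank-neg-< i _ (succF-< i e)
arrow-rank (pos→zer {i = i} _) = toℕ<n i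
arrow-rank (zer→neg {i = i} _) = rank-zer<neg i

arrow³-impossible : ∀ {x y z w} → x ─[ i ]→ y → y ─[ i ]→ z → ¬ z ─[ i ]→ w
arrow³-impossible (pos→pos {i = i} e) (pos→pos _) _ = succF-irrefl i e
arrow³-impossible (pos→pos {i = i} e) (pos→zer _) _ = succF-irrefl i e
arrow³-impossible (neg→neg _) (neg→neg {i = i} e) _ = succF-irrefl i e
arrow³-impossible (pos→zer _) (zer→neg _) (neg→neg {i = i} e) = succF-irrefl i e
arrow³-impossible (zer→neg _) (neg→neg {i = i} e) _ = succF-irrefl i e

rank-injective : (x y : Letter n) → rank x ≡ rank y → x ≡ y
rank-injective (pos k) (pos l) eq = cong pos (toℕ-injective eq)
rank-injective (pos k) zer     eq = ⊥-elim (ℕ.<⇒≢ (toℕ<n k) eq)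
rank-injective (pos k) (neg l) eq = ⊥-elim (ℕ.<⇒≢ (rank-pos<neg k l) eq)
rank-injective zer     (pos l) eq = ⊥-elim (ℕ.<⇒≢ (toℕ<n l) (sym eq))
rank-injective zer     zer     eq = refl
rank-injective zer     (neg l) eq = ⊥-elim (ℕ.<⇒≢ (rank-zer<neg l) eq)
rank-injective (neg k) (pos l) eq = ⊥-elim (ℕ.<⇒≢ (rank-pos<neg l k) (sym eq))
rank-injective (neg k) zer     eq = ⊥-elim (ℕ.<⇒≢ (rank-zer<neg k) (sym eq))
rank-injective (neg k) (neg l) eq =
  cong neg (toℕ-injective (ℕ.≤-antisym (rank-neg-≤⁻ k l (ℕ.≤-reflexive (sym eq)))
                                        (rank-neg-≤⁻ l k (ℕ.≤-reflexive eq))))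

-- The crystal of spin columns

infix 4 _═[_]⇒_

data _═[_]⇒_ {n} : SpinCol n → Fin n → SpinCol n → Set where
  inner : ∀ {C} → succF i ≡ just j → lookup C i ≡ true → lookup C j ≡ false →
          C ═[ i ]⇒ C [ i ]≔ false [ j ]≔ true
  last  : ∀ {C} → succF i ≡ nothing → lookup C i ≡ true → C ═[ i ]⇒ C [ i ]≔ false

fCol-arrow : ∀ (i : Fin n) C {D} → fCol i C ≡ just D → C ═[ i ]⇒ D
fCol-arrow i C f with succF i in e
... | just j with lookup C i in ci | lookup C j in cj
fCol-arrow i C refl | just j | true  | false = inner e ci cj
fCol-arrow i C ()   | just j | true  | true
fCol-arrow i C ()   | just j | false | _
fCol-arrow i C f | nothing with lookup C i in ci
fCol-arrow i C refl | nothing | true = last e ci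

arrow-fCol : ∀ {C D} → C ═[ i ]⇒ D → fCol i C ≡ just D
arrow-fCol (inner e ci cj) rewrite e | ci | cj = refl
arrow-fCol (last e ci)     rewrite e | ci      = refl

arrow-eCol : ∀ {C D} → C ═[ i ]⇒ D → eCol i D ≡ just C
arrow-eCol {i = i} {C} (inner {j = j} e ci cj)
  rewrite e | lookup∘update²-first C {x = false} {true} (succF-≢ i e)
          | Vecₚ.lookup∘update j (C [ i ]≔ false) true
  = cong just ([]≔²-revert C (succF-≢ i e) ci cj)
arrow-eCol {i = i} {C} (last e ci)
  rewrite e | Vecₚ.lookup∘update i C false = cong just ([]≔-revert C i ci)

eCol-arrow : ∀ (i : Fin n) D {C} → eCol i D ≡ just C → C ═[ i ]⇒ D
eCol-arrow i D f with succF i in e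
... | just j with lookup D i in di | lookup D j in dj
eCol-arrow i D refl | just j | false | true =
  subst (D [ i ]≔ true [ j ]≔ false ═[ i ]⇒_) ([]≔²-revert D (succF-≢ i e) di dj)
        (inner e (lookup∘update²-first D (succF-≢ i e)) (Vecₚ.lookup∘update j (D [ i ]≔ true) false))
eCol-arrow i D () | just j | false | false
eCol-arrow i D () | just j | true  | _
eCol-arrow i D f | nothing with lookup D i in di
eCol-arrow i D refl | nothing | false =
  subst (D [ i ]≔ true ═[ i ]⇒_) ([]≔-revert D i di) (last e (Vecₚ.lookup∘update i D true))

arrow-source : ∀ {C D} → C ═[ i ]⇒ D → lookup C i ≡ true
arrow-source (inner _ ci _) = ci
arrow-source (last _ ci)    = ci

arrow-target : ∀ {C D} → C ═[ i ]⇒ D → lookup D i ≡ false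
arrow-target {i = i} {C} (inner e _ _) = lookup∘update²-first C (succF-≢ i e)
arrow-target {i = i} {C} (last _ _)    = Vecₚ.lookup∘update i C false

arrow²-impossible : ∀ {C D E} → C ═[ i ]⇒ D → ¬ D ═[ i ]⇒ E
arrow²-impossible C⇒D D⇒E with () ← trans (sym (arrow-target C⇒D)) (arrow-source D⇒E)

arrow-below : ∀ {C D} → C ═[ i ]⇒ D → ∀ l → toℕ l < toℕ i → lookup D l ≡ lookup C l
arrow-below {C = C} (inner {i = i} e _ _) l l<i =
  lookup∘update²′ C {x = false} {true} (<⇒≢ l<i) (<⇒≢ (ℕ.<-trans l<i (succF-< i e)))
arrow-below {C = C} (last _ _) l l<i = Vecₚ.lookup∘update′ (<⇒≢ l<i) C false

-- An absent entry at position k of a length-m column weighs m − k, so column arrows raise the depth.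
depth : ∀ {m} → Vec Bool m → ℕ
depth []              = 0
depth {suc m} (b ∷ C) = (if b then 0 else suc m) ℕ.+ depth C

depth-swap : ∀ {m} (C : Vec Bool m) (i j : Fin m) → toℕ j ≡ suc (toℕ i) →
             lookup C i ≡ true → lookup C j ≡ false → depth C < depth (C [ i ]≔ false [ j ]≔ true)
depth-swap (true ∷ false ∷ C) zero    (suc zero)    refl refl refl = ℕ.≤-refl
depth-swap (_ ∷ _)            zero    (suc (suc _)) ()
depth-swap (_ ∷ _)            (suc _) zero          ()
depth-swap {suc m} (b ∷ C) (suc i) (suc j) e ci cj =
  ℕ.+-monoʳ-< (if b then 0 else suc m) (depth-swap C i j (ℕ.suc-injective e) ci cj)

depth-clear : ∀ {m} (C : Vec Bool m) (i : Fin m) → lookup C i ≡ true → depth C < depth (C [ i ]≔ false)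
depth-clear {suc m} (true ∷ C) zero    refl = s≤s (ℕ.m≤n+m (depth C) m)
depth-clear {suc m} (b ∷ C)    (suc i) ci   = ℕ.+-monoʳ-< (if b then 0 else suc m) (depth-clear C i ci)

AllTrue : Vec Bool n → Set
AllTrue C = ∀ l → lookup C l ≡ true

LastFalse : Vec Bool n → Fin n → Set
LastFalse C k = lookup C k ≡ false × (∀ l → toℕ k < toℕ l → lookup C l ≡ true)

allTrue-or-firstFalse : ∀ {n} (C : Vec Bool n) →
  AllTrue C ⊎ ∃ λ k → lookup C k ≡ false × (∀ l → toℕ l < toℕ k → lookup C l ≡ true)
allTrue-or-firstFalse [] = inj₁ λ ()
allTrue-or-firstFalse (false ∷ C) = inj₂ (zero , refl , λ _ ())
allTrue-or-firstFalse (true ∷ C) with allTrue-or-firstFalse C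
... | inj₁ all              = inj₁ λ { zero → refl ; (suc l) → all l }
... | inj₂ (k , Ck , below) = inj₂ (suc k , Ck , λ { zero _ → refl ; (suc l) (s≤s l<k) → below l l<k })

allTrue-or-lastFalse : ∀ {n} (C : Vec Bool n) → AllTrue C ⊎ ∃ (LastFalse C)
allTrue-or-lastFalse [] = inj₁ λ ()
allTrue-or-lastFalse (b ∷ C) with allTrue-or-lastFalse C
... | inj₂ (k , Ck , above) = inj₂ (suc k , Ck , λ { zero () ; (suc l) (s≤s k<l) → above l k<l })
allTrue-or-lastFalse (true ∷ C)  | inj₁ all = inj₁ λ { zero → refl ; (suc l) → all l }
allTrue-or-lastFalse (false ∷ C) | inj₁ all = inj₂ (zero , refl , λ { zero () ; (suc l) _ → all l })

topCol-allTrue : AllTrue (topCol n)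
topCol-allTrue l = Vecₚ.lookup-replicate l true

allTrue⇒topCol : ∀ {n} (C : SpinCol n) → AllTrue C → C ≡ topCol n
allTrue⇒topCol []      _   = refl
allTrue⇒topCol (b ∷ C) all = cong₂ _∷_ (all zero) (allTrue⇒topCol C (all ∘ suc))

infix 4 _⇝[_]_

data _⇝[_]_ {n} : GLetter n → Fin n → GLetter n → Set where
  letter : ∀ {x y} → x ─[ i ]→ y → letter x ⇝[ i ] letter y
  col    : ∀ {C D} → C ═[ i ]⇒ D → col C ⇝[ i ] col D

fG-arrow : ∀ (i : Fin n) a {b} → fG i a ≡ just b → a ⇝[ i ] b
fG-arrow i (letter x) f with fLet i x in e
fG-arrow i (letter x) refl | just _ = letter (fLet-arrow i x e)
fG-arrow i (col C) f with fCol i C in e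
fG-arrow i (col C) refl | just _ = col (fCol-arrow i C e)

eG-arrow : ∀ (i : Fin n) b {a} → eG i b ≡ just a → a ⇝[ i ] b
eG-arrow i (letter y) f with eLet i y in e
eG-arrow i (letter y) refl | just _ = letter (eLet-arrow i y e)
eG-arrow i (col D) f with eCol i D in e
eG-arrow i (col D) refl | just _ = col (eCol-arrow i D e)

arrow-fG : ∀ {a b} → a ⇝[ i ] b → fG i a ≡ just b
arrow-fG (letter x→y) = cong (Maybe.map letter) (arrow-fLet x→y)
arrow-fG (col C⇒D)    = cong (Maybe.map col) (arrow-fCol C⇒D)

arrow-eG : ∀ {a b} → a ⇝[ i ] b → eG i b ≡ just a
arrow-eG (letter x→y) = cong (Maybe.map letter) (arrow-eLet x→y)
arrow-eG (col C⇒D)    = cong (Maybe.map col) (arrow-eCol C⇒D)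

-- Source i b and Sink i a say εᵢ(b) = 0 and φᵢ(a) = 0.
Source : Fin n → GLetter n → Set
Source i b = ∀ {a} → ¬ a ⇝[ i ] b

Sink : Fin n → GLetter n → Set
Sink i a = ∀ {b} → ¬ a ⇝[ i ] b

fG-none : ∀ {a} → Sink i a → fG i a ≡ nothing
fG-none {i = i} {a} noArrow with fG i a in f
... | nothing = refl
... | just _  = ⊥-elim (noArrow (fG-arrow i a f))

eG-none : ∀ {b} → Source i b → eG i b ≡ nothing
eG-none {i = i} {b} noArrow with eG i b in f
... | nothing = refl
... | just _  = ⊥-elim (noArrow (eG-arrow i b f))

⇝³-impossible : ∀ {a b c d} → a ⇝[ i ] b → b ⇝[ i ] c → ¬ c ⇝[ i ] d
⇝³-impossible (letter x→y) (letter y→z) (letter z→w) = arrow³-impossible x→y y→z z→w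
⇝³-impossible (col C⇒D)    (col D⇒E)    _            = arrow²-impossible C⇒D D⇒E

strLen-none : ∀ {A : Set} k (g : A → Maybe A) {a} → g a ≡ nothing → strLen k g a ≡ 0
strLen-none zero    g _ = refl
strLen-none (suc k) g e rewrite e = refl

-- No i-string has three arrows, so the fuel 3 of φG and εG never runs out.
strLen-shift : ∀ {A : Set} (g : A → Maybe A) →
               (∀ {a b c} → g a ≡ just b → g b ≡ just c → g c ≡ nothing) →
               ∀ {a b} → g a ≡ just b → strLen 3 g a ≡ suc (strLen 3 g b)
strLen-shift g short {a} {b} e rewrite e with g b in e₁
... | nothing = refl
... | just c with g c in e₂
...   | nothing = refl
...   | just d rewrite short {b} e₁ e₂ = refl

φG-arrow : ∀ {a b} → a ⇝[ i ] b → φG i a ≡ suc (φG i b)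
φG-arrow {i = i} {a} a⇝b = strLen-shift (fG i) (λ {a} → short {a}) {a} (arrow-fG a⇝b)
  where
  short : ∀ {a b c} → fG i a ≡ just b → fG i b ≡ just c → fG i c ≡ nothing
  short {a} {b} {c} f₁ f₂ = fG-none {a = c} (⇝³-impossible (fG-arrow i a f₁) (fG-arrow i b f₂))

εG-arrow : ∀ {a b} → a ⇝[ i ] b → εG i b ≡ suc (εG i a)
εG-arrow {i = i} {b = b} a⇝b = strLen-shift (eG i) (λ {a} → short {a}) {b} (arrow-eG a⇝b)
  where
  short : ∀ {a b c} → eG i a ≡ just b → eG i b ≡ just c → eG i c ≡ nothing
  short {a} {b} {c} e₁ e₂ =
    eG-none {b = c} λ d⇝c → ⇝³-impossible d⇝c (eG-arrow i b e₂) (eG-arrow i a e₁)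

φG-none : ∀ {a} → Sink i a → φG i a ≡ 0
φG-none {i = i} {a} noArrow = strLen-none 3 (fG i) {a} (fG-none noArrow)

εG-none : ∀ {b} → Source i b → εG i b ≡ 0
εG-none {i = i} {b} noArrow = strLen-none 3 (eG i) {b} (eG-none noArrow)

next? : ∀ (i : Fin n) a → (∃ λ b → a ⇝[ i ] b) ⊎ Sink i a
next? i a with fG i a in f
... | just b  = inj₁ (b , fG-arrow i a f)
... | nothing = inj₂ λ a⇝b → case trans (sym f) (arrow-fG a⇝b) of λ ()

prev? : ∀ (i : Fin n) b → (∃ λ a → a ⇝[ i ] b) ⊎ Source i b
prev? i b with eG i b in e
... | just a  = inj₁ (a , eG-arrow i b e)
... | nothing = inj₂ λ a⇝b → case trans (sym e) (arrow-eG a⇝b) of λ ()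

0<εG : ∀ {a b} → a ⇝[ i ] b → 0 < εG i b
0<εG a⇝b rewrite εG-arrow a⇝b = s≤s z≤n

0<φG : ∀ {a b} → a ⇝[ i ] b → 0 < φG i a
0<φG a⇝b rewrite φG-arrow a⇝b = s≤s z≤n

φG-col≤1 : ∀ (i : Fin n) C → φG i (col C) ≤ 1
φG-col≤1 i C with next? i (col C)
... | inj₁ (col D , col C⇒D) =
  ℕ.≤-reflexive (trans (φG-arrow (col C⇒D))
                       (cong suc (φG-none {a = col D} λ { (col D⇒E) → arrow²-impossible C⇒D D⇒E })))
... | inj₂ sink = subst (_≤ 1) (sym (φG-none sink)) z≤n

εG-col≤1 : ∀ (i : Fin n) D → εG i (col D) ≤ 1
εG-col≤1 i D with prev? i (col D)
... | inj₁ (col C , col C⇒D) =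
  ℕ.≤-reflexive (trans (εG-arrow (col C⇒D))
                       (cong suc (εG-none {b = col C} λ { (col B⇒C) → arrow²-impossible B⇒C C⇒D })))
... | inj₂ source = subst (_≤ 1) (sym (εG-none source)) z≤n

sink-pos : ∀ {p} → p ≢ k → Sink k (letter (pos p))
sink-pos p≢k (letter (pos→pos _)) = p≢k refl
sink-pos p≢k (letter (pos→zer _)) = p≢k refl

sink-neg : ∀ {p} → succF k ≢ just p → Sink k (letter (neg p))
sink-neg not-next (letter (neg→neg e)) = not-next e

sink-absent : ∀ {C} → lookup C i ≡ false → Sink i (col C)
sink-absent Ci (col C⇒D) = true≢false (arrow-source C⇒D) Ci

sink-blocked : ∀ {C} → succF i ≡ just j → lookup C j ≡ true → Sink i (col C)
sink-blocked e Cj (col (inner e′ _ Cj′)) with trans (sym e) e′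
... | refl = true≢false Cj Cj′
sink-blocked e Cj (col (last e′ _)) = succF-nothing≢just e′ e

source-present : ∀ {D} → lookup D i ≡ true → Source i (col D)
source-present Di (col C⇒D) = true≢false Di (arrow-target C⇒D)

source-col : ∀ {D} → succF k ≡ just j → lookup D j ≡ false → Source k (col D)
source-col {k = k} e Dj (col (inner {C = C} e′ _ _)) with trans (sym e) e′
... | refl = true≢false (Vecₚ.lookup∘update _ (C [ k ]≔ false) true) Dj
source-col e Dj (col (last e′ _)) = succF-nothing≢just e′ e

φG-pos-last : succF k ≡ nothing → φG k (letter (pos k)) ≡ 2
φG-pos-last {k = k} e = begin
  φG k (letter (pos k))      ≡⟨ φG-arrow (letter (pos→zer e)) ⟩
  suc (φG k (letter zer))     ≡⟨ cong suc (φG-arrow (letter (zer→neg e))) ⟩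
  2 ℕ.+ φG k (letter (neg k)) ≡⟨ cong (2 ℕ.+_) (φG-none {a = letter (neg k)} sink) ⟩
  2                           ∎
  where
  open ≡-Reasoning
  sink = sink-neg (succF-nothing≢just e)

infixr 25 _⊗_

_⊗_ : GLetter n → GLetter n → Word n
a ⊗ b = a ∷ b ∷ []

εW-single : (i : Fin n) (b : GLetter n) → εW i (b ∷ []) ≡ εG i b
εW-single i b rewrite ℕ.0∸n≡0 (φG i b) = ℕ.+-identityʳ _

fW-single : (i : Fin n) (b : GLetter n) → fW i (b ∷ []) ≡ Maybe.map (_∷ []) (fG i b)
fW-single i b with next? i b
... | inj₁ (_ , b⇝b′) rewrite φG-arrow b⇝b′ | arrow-fG b⇝b′ = refl
... | inj₂ sink       rewrite φG-none {i = i} {b} sink | fG-none {i = i} {b} sink = refl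

infix 4 _⟹[_]_

data _⟹[_]_ {n} : Word n → Fin n → Word n → Set where
  left  : ∀ {a a′ b} → εG i b < φG i a → a ⇝[ i ] a′ → a ⊗ b ⟹[ i ] a′ ⊗ b
  right : ∀ {a b b′} → φG i a ≤ εG i b → b ⇝[ i ] b′ → a ⊗ b ⟹[ i ] a ⊗ b′

fW-⊗-left : ∀ {i : Fin n} {a b} → εG i b < φG i a → fW i (a ⊗ b) ≡ Maybe.map (_⊗ b) (fG i a)
fW-⊗-left {i = i} {b = b} εb<φa rewrite εW-single i b | <ᵇ-true εb<φa = refl

fW-⊗-right : ∀ {i : Fin n} {a b} → φG i a ≤ εG i b → fW i (a ⊗ b) ≡ Maybe.map (a ⊗_) (fG i b)
fW-⊗-right {i = i} {b = b} φa≤εb rewrite εW-single i b | <ᵇ-false φa≤εb | fW-single i b with fG i b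
... | nothing = refl
... | just _  = refl

eW-⊗-left : ∀ {i : Fin n} {a b} → εG i b ≤ φG i a → eW i (a ⊗ b) ≡ Maybe.map (_⊗ b) (eG i a)
eW-⊗-left {i = i} {b = b} εb≤φa rewrite εW-single i b | <ᵇ-false εb≤φa = refl

eW-⊗-right : ∀ {i : Fin n} {a b} → φG i a < εG i b → eW i (a ⊗ b) ≡ Maybe.map (a ⊗_) (eG i b)
eW-⊗-right {i = i} {b = b} φa<εb rewrite εW-single i b | <ᵇ-true φa<εb with eG i b
... | nothing = refl
... | just _  = refl

fW-⊗ : ∀ (i : Fin n) a b {w} → fW i (a ⊗ b) ≡ just w → a ⊗ b ⟹[ i ] w
fW-⊗ i a b f with εG i b ℕ.<? φG i a
... | yes εb<φa with map-just⁻ {g = _⊗ b} (fG i a) (trans (sym (fW-⊗-left {a = a} {b} εb<φa)) f)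
...   | _ , fa , refl = left εb<φa (fG-arrow i a fa)
fW-⊗ i a b f | no εb≮φa
  with map-just⁻ {g = a ⊗_} (fG i b) (trans (sym (fW-⊗-right {a = a} {b} (ℕ.≮⇒≥ εb≮φa))) f)
...   | _ , fb , refl = right (ℕ.≮⇒≥ εb≮φa) (fG-arrow i b fb)

eW-⊗ : ∀ (i : Fin n) a b {u} → eW i (a ⊗ b) ≡ just u → u ⟹[ i ] a ⊗ b
eW-⊗ i a b e with φG i a ℕ.<? εG i b
... | yes φa<εb with map-just⁻ {g = a ⊗_} (eG i b) (trans (sym (eW-⊗-right {a = a} {b} φa<εb)) e)
...   | _ , eb , refl = right (ℕ.≤-pred (subst (φG i a <_) (εG-arrow b₀⇝b) φa<εb)) b₀⇝b
  where b₀⇝b = eG-arrow i b eb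
eW-⊗ i a b e | no φa≮εb
  with map-just⁻ {g = _⊗ b} (eG i a) (trans (sym (eW-⊗-left {a = a} {b} (ℕ.≮⇒≥ φa≮εb))) e)
...   | _ , ea , refl = left (subst (εG i b <_) (sym (φG-arrow a₀⇝a)) (s≤s (ℕ.≮⇒≥ φa≮εb))) a₀⇝a
  where a₀⇝a = eG-arrow i a ea

⟹-fW : ∀ {u w} → u ⟹[ i ] w → fW i u ≡ just w
⟹-fW (left {a = a} {b = b} εb<φa a⇝a′) =
  trans (fW-⊗-left {a = a} {b} εb<φa) (cong (Maybe.map (_⊗ b)) (arrow-fG a⇝a′))
⟹-fW (right {a = a} {b = b} φa≤εb b⇝b′) =
  trans (fW-⊗-right {a = a} {b} φa≤εb) (cong (Maybe.map (a ⊗_)) (arrow-fG b⇝b′))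

⟹-eW : ∀ {u w} → u ⟹[ i ] w → eW i w ≡ just u
⟹-eW {i = i} (left {a′ = a′} {b = b} εb<φa a⇝a′) =
  trans (eW-⊗-left {a = a′} {b} (ℕ.≤-pred (subst (εG i b <_) (φG-arrow a⇝a′) εb<φa)))
        (cong (Maybe.map (_⊗ b)) (arrow-eG a⇝a′))
⟹-eW {i = i} (right {a = a} {b′ = b′} φa≤εb b⇝b′) =
  trans (eW-⊗-right {a = a} {b′} (subst (φG i a <_) (sym (εG-arrow b⇝b′)) (s≤s φa≤εb)))
        (cong (Maybe.map (a ⊗_)) (arrow-eG b⇝b′))

left-free : ∀ {a a′ b} → Source i b → a ⇝[ i ] a′ → a ⊗ b ⟹[ i ] a′ ⊗ b
left-free {i = i} {b = b} source a⇝a′ =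
  left (subst (_< _) (sym (εG-none {i = i} {b} source)) (0<φG a⇝a′)) a⇝a′

right-free : ∀ {a b b′} → Sink i a → b ⇝[ i ] b′ → a ⊗ b ⟹[ i ] a ⊗ b′
right-free {i = i} {a} sink b⇝b′ = right (subst (_≤ _) (sym (φG-none {i = i} {a} sink)) z≤n) b⇝b′

μG : GLetter n → ℕ
μG (letter x) = rank x
μG (col C)    = depth C

μ : Word n → ℕ
μ []      = 0
μ (a ∷ w) = μG a ℕ.+ μ w

⇝-μG : ∀ {a b} → a ⇝[ i ] b → μG a < μG b
⇝-μG (letter x→y)                   = arrow-rank x→y
⇝-μG (col (inner {i = i} {C = C} e ci cj)) = depth-swap C i _ (succF-toℕ i e) ci cj
⇝-μG (col (last {i = i} {C = C} _ ci))     = depth-clear C i ci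

⟹-μ : ∀ {u w} → u ⟹[ i ] w → μ u < μ w
⟹-μ (left {b = b} _ a⇝a′)  = ℕ.+-monoˡ-< (μG b ℕ.+ 0) (⇝-μG a⇝a′)
⟹-μ (right {a = a} _ b⇝b′) = ℕ.+-monoʳ-< (μG a) (ℕ.+-monoˡ-< 0 (⇝-μG b⇝b′))

_▵′_ : Letter n → SpinCol n → Set
pos _ ▵′ C = ⊥
zer   ▵′ C = ∀ l → lookup C l ≡ true
neg k ▵′ C = ∀ l → toℕ l ≤ toℕ k → lookup C l ≡ true

▵⇒▵′ : ∀ (C : SpinCol n) x → x ▵ C → x ▵′ C
▵⇒▵′ C (pos j) (z , (_ , greatest) , x⋠z) with lookup C j in Cj
... | true  = x⋠z (greatest (pos j) Cj)
... | false = x⋠z (ℕ.≤-trans (ℕ.<⇒≤ (rank-pos<neg j j)) (greatest (neg j) Cj))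
▵⇒▵′ C zer (z , (_ , greatest) , x⋠z) l with lookup C l in Cl
... | true  = refl
... | false = ⊥-elim (x⋠z (ℕ.≤-trans (ℕ.<⇒≤ (rank-zer<neg l)) (greatest (neg l) Cl)))
▵⇒▵′ C (neg j) (z , (_ , greatest) , x⋠z) l l≤j with lookup C l in Cl
... | true  = refl
... | false = ⊥-elim (x⋠z (ℕ.≤-trans (rank-neg-≤ l j l≤j) (greatest (neg l) Cl)))

greatest-allTrue : ∀ {m} (C : SpinCol (suc m)) → AllTrue C → IsGreatest C (pos (Fin.fromℕ m))
greatest-allTrue {m} C all = all _ , λ
  { (pos k) _   → subst (toℕ k ≤_) (sym (toℕ-fromℕ m)) (ℕ.≤-pred (toℕ<n k))
  ; zer     ()
  ; (neg k) Ck → ⊥-elim (true≢false (all k) Ck) }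

greatest-firstFalse : ∀ (C : SpinCol n) k → lookup C k ≡ false → (∀ l → toℕ l < toℕ k → lookup C l ≡ true) →
                      IsGreatest C (neg k)
greatest-firstFalse C k Ck below = Ck , λ
  { (pos l) _   → ℕ.<⇒≤ (rank-pos<neg l k)
  ; zer     ()
  ; (neg l) Cl → rank-neg-≤ k l (ℕ.≮⇒≥ λ l<k → true≢false (below l l<k) Cl) }

▵′⇒▵ : ∀ {m} (C : SpinCol (suc m)) x → x ▵′ C → x ▵ C
▵′⇒▵ {m} C zer all = pos (Fin.fromℕ m) , greatest-allTrue C all , ℕ.<⇒≱ (toℕ<n (Fin.fromℕ m))
▵′⇒▵ {m} C (neg j) C⊇ with allTrue-or-firstFalse C
... | inj₁ all              =
  pos (Fin.fromℕ m) , greatest-allTrue C all , ℕ.<⇒≱ (rank-pos<neg (Fin.fromℕ m) j)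
... | inj₂ (k , Ck , below) = neg k , greatest-firstFalse C k Ck below ,
                              λ j⪯k → true≢false (C⊇ k (rank-neg-≤⁻ k j j⪯k)) Ck

-- ▵ is constant on components

ε<φ⇒no-arrow-into : ∀ {C x} → εG i (letter x) < φG i (col C) → ∀ {y} → ¬ y ─[ i ]→ x
ε<φ⇒no-arrow-into {i = i} {C} lt y→x = ℕ.<⇒≱ lt (ℕ.≤-trans (φG-col≤1 i C) (0<εG (letter y→x)))

φ≤ε⇒no-arrow-from : ∀ {C x} → φG i (col C) ≤ εG i (letter x) → (∀ {y} → ¬ y ─[ i ]→ x) →
                    ∀ {D} → ¬ C ═[ i ]⇒ D
φ≤ε⇒no-arrow-from {x = x} le none C⇒D =
  ℕ.<⇒≱ (0<φG (col C⇒D)) (subst (_ ≤_) (εG-none {b = letter x} λ { (letter y→x) → none y→x }) le)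

neg-below-arrow : ∀ {C C′ m} → C ═[ i ]⇒ C′ → (∀ {y} → ¬ y ─[ i ]→ neg m) → neg m ▵′ C → toℕ m < toℕ i
neg-below-arrow {m = m} (inner {i = i} e _ Cj) none C⊇ = ℕ.≤∧≢⇒< m≤i (m≢i ∘ toℕ-injective)
  where
  m≤i : toℕ m ≤ toℕ i
  m≤i = ℕ.≮⇒≥ λ i<m → true≢false (C⊇ _ (subst (_≤ toℕ m) (sym (succF-toℕ i e)) i<m)) Cj
  m≢i : m ≢ i
  m≢i refl = none (neg→neg e)
neg-below-arrow {m = m} (last {i = i} e _) none C⊇ = ℕ.≤∧≢⇒< (last-≤ i e m) (m≢i ∘ toℕ-injective)
  where
  m≢i : m ≢ i
  m≢i refl = none (zer→neg e)

▵′-col-forward : ∀ {C C′ x} → εG i (letter x) < φG i (col C) → C ═[ i ]⇒ C′ → x ▵′ C → x ▵′ C′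
▵′-col-forward {x = zer} _ (inner _ _ Cj) all = ⊥-elim (true≢false (all _) Cj)
▵′-col-forward {x = zer} lt (last e _) _ = ⊥-elim (ε<φ⇒no-arrow-into lt (pos→zer e))
▵′-col-forward {x = neg m} lt C⇒C′ C⊇ l l≤m =
  trans (arrow-below C⇒C′ l (ℕ.≤-<-trans l≤m (neg-below-arrow C⇒C′ (ε<φ⇒no-arrow-into lt) C⊇)))
        (C⊇ l l≤m)

▵′-col-backward : ∀ {C C′ x} → C ═[ i ]⇒ C′ → x ▵′ C′ → x ▵′ C
▵′-col-backward {x = zer} C⇒C′ all = ⊥-elim (true≢false (all _) (arrow-target C⇒C′))
▵′-col-backward {i = i} {x = neg m} C⇒C′ C′⊇ l l≤m =
  trans (sym (arrow-below C⇒C′ l (ℕ.≤-<-trans l≤m m<i))) (C′⊇ l l≤m)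
  where
  m<i : toℕ m < toℕ i
  m<i = ℕ.≰⇒> λ i≤m → true≢false (C′⊇ i i≤m) (arrow-target C⇒C′)

▵′-letter-forward : ∀ {C x x′} → x ─[ i ]→ x′ → x ▵′ C → x′ ▵′ C
▵′-letter-forward (neg→neg {i = i} e) C⊇ l l≤i = C⊇ l (ℕ.≤-trans l≤i (ℕ.<⇒≤ (succF-< i e)))
▵′-letter-forward (zer→neg _)         all l _ = all l

▵′-letter-backward : ∀ {C x x′} → φG i (col C) ≤ εG i (letter x) → x ─[ i ]→ x′ → x′ ▵′ C → x ▵′ C
▵′-letter-backward le (pos→zer e) all = φ≤ε⇒no-arrow-from le none (last e (all _))
  where
  none : ∀ {y} → ¬ y ─[ _ ]→ pos _
  none (pos→pos e′) = succF-nothing≢just e e′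
▵′-letter-backward {i = i} {C} le (neg→neg {j = j} e) C⊇ l l≤j with lookup C j in Cj | l Fin.≟ j
... | true  | yes refl = Cj
... | _     | no l≢j   = C⊇ l (inner-≤ i e l l≤j l≢j)
... | false | yes refl = ⊥-elim (φ≤ε⇒no-arrow-from le none (inner e (C⊇ i ℕ.≤-refl) Cj))
  where
  none : ∀ {y} → ¬ y ─[ i ]→ neg j
  none (neg→neg e′) = succF-irrefl i e
  none (zer→neg e′) = succF-nothing≢just e′ e
▵′-letter-backward _ (zer→neg {i = i} e) C⊇ l = C⊇ l (last-≤ i e l)

▵′-forward : ∀ {C C′ x x′} → col C ⊗ letter x ⟹[ i ] col C′ ⊗ letter x′ → x ▵′ C → x′ ▵′ C′
▵′-forward (left  lt (col C⇒C′))   = ▵′-col-forward lt C⇒C′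
▵′-forward (right _  (letter x→x′)) = ▵′-letter-forward x→x′

▵′-backward : ∀ {C C′ x x′} → col C ⊗ letter x ⟹[ i ] col C′ ⊗ letter x′ → x′ ▵′ C′ → x ▵′ C
▵′-backward (left  _  (col C⇒C′))   = ▵′-col-backward C⇒C′
▵′-backward (right le (letter x→x′)) = ▵′-letter-backward le x→x′

PairInvariant : (SpinCol n → Letter n → Set) → Set
PairInvariant {n} P = ∀ {i : Fin n} {C C′ x x′} → col C ⊗ letter x ⟹[ i ] col C′ ⊗ letter x′ →
                      (P C x → P C′ x′) × (P C′ x′ → P C x)

▵′-invariant : PairInvariant {n} (λ C x → x ▵′ C)
▵′-invariant step = ▵′-forward step , ▵′-backward step

¬▵′-invariant : PairInvariant {n} (λ C x → ¬ x ▵′ C)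
¬▵′-invariant step = (λ ¬▵′ → ¬▵′ ∘ ▵′-backward step) , (λ ¬▵′ → ¬▵′ ∘ ▵′-forward step)

⟹-from-pair : ∀ {C x w} → col C ⊗ letter x ⟹[ i ] w → ∃₂ λ C′ x′ → w ≡ col C′ ⊗ letter x′
⟹-from-pair (left  _ (col _))    = _ , _ , refl
⟹-from-pair (right _ (letter _)) = _ , _ , refl

⟹-into-pair : ∀ {C x u} → u ⟹[ i ] col C ⊗ letter x → ∃₂ λ C′ x′ → u ≡ col C′ ⊗ letter x′
⟹-into-pair (left  _ (col _))    = _ , _ , refl
⟹-into-pair (right _ (letter _)) = _ , _ , refl

component-invariant : ∀ {P : SpinCol n → Letter n → Set} → PairInvariant P → ∀ {C₀ x₀ w} → P C₀ x₀ →
                      col C₀ ⊗ letter x₀ ∼ w → ∃₂ λ C x → w ≡ col C ⊗ letter x × P C x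
component-invariant inv p₀ here = _ , _ , refl , p₀
component-invariant inv p₀ (fstep i path f) with component-invariant inv p₀ path
... | C , x , refl , p with fW-⊗ i (col C) (letter x) f
...   | step with ⟹-from-pair step
...     | C′ , x′ , refl = C′ , x′ , refl , proj₁ (inv step) p
component-invariant inv p₀ (estep i path e) with component-invariant inv p₀ path
... | C , x , refl , p with eW-⊗ i (col C) (letter x) e
...   | step with ⟹-into-pair step
...     | C′ , x′ , refl = C′ , x′ , refl , proj₂ (inv step) p

-- Descent to the highest weight words

lastFalse-arrow : ∀ {C} → LastFalse C k → ∃ λ C₀ → C₀ ═[ k ]⇒ C
lastFalse-arrow {k = k} {C} (Ck , above) with node k
... | inner j e = _ , eCol-arrow k C eCol-just
  where
  eCol-just : eCol k C ≡ just (C [ k ]≔ true [ j ]≔ false)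
  eCol-just rewrite e | Ck | above j (succF-< k e) = refl
... | last e = _ , eCol-arrow k C eCol-just
  where
  eCol-just : eCol k C ≡ just (C [ k ]≔ true)
  eCol-just rewrite e | Ck = refl

step-into : ∀ {C₀ C} → C₀ ═[ k ]⇒ C → ∀ x → ∃₂ λ C′ x′ → col C′ ⊗ letter x′ ⟹[ k ] col C ⊗ letter x
step-into {k = k} C₀⇒C x with prev? k (letter x)
... | inj₁ (letter y , letter y→x) = _ , _ , right-free (sink-absent (arrow-target C₀⇒C)) (letter y→x)
... | inj₂ source                  = _ , _ , left-free source (col C₀⇒C)

Highest : SpinCol (suc n) → Letter (suc n) → Set
Highest C x = AllTrue C × (x ≡ zer ⊎ x ≡ pos zero)

-- step-from records how i was chosen: as the last absent entry of C, or from x when C = {1,…,n}.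
data Descent {n} (C : SpinCol (suc n)) (x : Letter (suc n)) : Set where
  highest   : Highest C x → Descent C x
  step-from : ∀ {i C₀ x₀} → LastFalse C i ⊎ AllTrue C →
              col C₀ ⊗ letter x₀ ⟹[ i ] col C ⊗ letter x → Descent C x

descent : ∀ (C : SpinCol (suc n)) x → Descent C x
descent C x with allTrue-or-lastFalse C
... | inj₂ (k , lastFalse) with step-into (proj₂ (lastFalse-arrow lastFalse)) x
...   | _ , _ , step = step-from (inj₁ lastFalse) step
descent C zer     | inj₁ all = highest (all , inj₁ refl)
descent C (pos j) | inj₁ all with predecessor j
... | inj₁ refl    = highest (all , inj₂ refl)
... | inj₂ (i , e) = step-from (inj₂ all) (right-free (sink-blocked e (all j)) (letter (pos→pos e)))
descent C (neg m) | inj₁ all with node m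
... | inner j e = step-from (inj₂ all) (right-free (sink-blocked e (all j)) (letter (neg→neg e)))
... | last e    = step-from (inj₂ all)
                    (right (ℕ.≤-trans (φG-col≤1 m C) (0<εG (letter (pos→zer e)))) (letter (zer→neg e)))

reach : ∀ {P : SpinCol (suc n) → Letter (suc n) → Set} {w₀} → PairInvariant P →
        (∀ {C x} → P C x → Highest C x → w₀ ≡ col C ⊗ letter x) →
        ∀ {C x} → P C x → w₀ ∼ col C ⊗ letter x
reach {P = P} {w₀} inv base {C} {x} p = go C x p (<-wellFounded (μ (col C ⊗ letter x)))
  where
  go : ∀ C x → P C x → Acc _<_ (μ (col C ⊗ letter x)) → w₀ ∼ col C ⊗ letter x
  go C x p (acc smaller) with descent C x
  ... | highest h = subst (w₀ ∼_) (base p h) here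
  ... | step-from {i} {C₀} {x₀} _ step =
    fstep i (go C₀ x₀ (proj₂ (inv step) p) (smaller (⟹-μ step))) (⟹-fW step)

reach-▵′ : ∀ {C : SpinCol (suc n)} {x} → x ▵′ C → w-v0 (suc n) ∼ col C ⊗ letter x
reach-▵′ = reach ▵′-invariant base
  where
  base : ∀ {C x} → x ▵′ C → Highest C x → w-v0 (suc n) ≡ col C ⊗ letter x
  base _  (all , inj₁ refl) = cong (λ D → col D ⊗ letter zer) (sym (allTrue⇒topCol _ all))
  base () (_   , inj₂ refl)

reach-¬▵′ : ∀ {C : SpinCol (suc n)} {x} → ¬ x ▵′ C → w-v1 (suc n) ∼ col C ⊗ letter x
reach-¬▵′ = reach ¬▵′-invariant base
  where
  base : ∀ {C x} → ¬ x ▵′ C → Highest C x → w-v1 (suc n) ≡ col C ⊗ letter x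
  base ¬▵′ (all , inj₁ refl) = ⊥-elim (¬▵′ all)
  base _   (all , inj₂ refl) = cong (λ D → col D ⊗ letter (pos zero)) (sym (allTrue⇒topCol _ all))

[m∸n]-[n∸m]≡m-n : ∀ m k → + (m ∸ k) - + (k ∸ m) ≡ + m - + k
[m∸n]-[n∸m]≡m-n m k with ℕ.≤-total k m
... | inj₁ k≤m rewrite ℕ.m≤n⇒m∸n≡0 k≤m =
  trans (ℤ.+-identityʳ _) (trans (sym (ℤ.⊖-≥ k≤m)) (sym (ℤ.m-n≡m⊖n m k)))
... | inj₂ m≤k rewrite ℕ.m≤n⇒m∸n≡0 m≤k =
  trans (ℤ.+-identityˡ _) (trans (sym (ℤ.⊖-≤ m≤k)) (sym (ℤ.m-n≡m⊖n m k)))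

m+n≡o⇒n≡o-m : ∀ {a b c : ℤ} → a + b ≡ c → b ≡ c - a
m+n≡o⇒n≡o-m {a} {b} refl = cancel a b
  where
  cancel : ∀ (a b : ℤ) → b ≡ (a + b) - a
  cancel = solve-∀

wtW : Fin n → Word n → ℤ
wtW i w = + φW i w - + εW i w

wtW-single : ∀ (i : Fin n) a → wtW i (a ∷ []) ≡ wtG a i
wtW-single i a = cong (λ ε → + φG i a - + ε) (εW-single i a)

wtW-⊗ : ∀ (i : Fin n) a b → wtW i (a ⊗ b) ≡ wtG a i + wtG b i
wtW-⊗ i a b rewrite εW-single i b = begin
  + (φb ℕ.+ (φa ∸ εb)) - + (εa ℕ.+ (εb ∸ φa))
    ≡⟨ cong₂ _-_ (ℤ.pos-+ φb _) (ℤ.pos-+ εa _) ⟩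
  (+ φb + + (φa ∸ εb)) - (+ εa + + (εb ∸ φa))
    ≡⟨ regroup (+ φb) (+ (φa ∸ εb)) (+ εa) (+ (εb ∸ φa)) ⟩
  (+ (φa ∸ εb) - + (εb ∸ φa)) + (+ φb - + εa)
    ≡⟨ cong (_+ (+ φb - + εa)) ([m∸n]-[n∸m]≡m-n φa εb) ⟩
  (+ φa - + εb) + (+ φb - + εa)
    ≡⟨ exchange (+ φa) (+ εb) (+ φb) (+ εa) ⟩
  (+ φa - + εa) + (+ φb - + εb) ∎
  where
  open ≡-Reasoning
  φa = φG i a; εa = εG i a; φb = φG i b; εb = εG i b
  regroup : ∀ (u x v y : ℤ) → (u + x) - (v + y) ≡ (x - y) + (u - v)
  regroup = solve-∀
  exchange : ∀ (p q r s : ℤ) → (p - q) + (r - s) ≡ (p - s) + (r - q)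
  exchange = solve-∀

iso-wtW : ∀ {a b : Word n} {Ψ} → CrystalIso a b Ψ → ∀ i {w} → a ∼ w → wtW i (Ψ w) ≡ wtW i w
iso-wtW iso i {w} a∼w =
  cong₂ (λ φ ε → + φ - + ε) (CrystalIso.φ-pres iso i w a∼w) (CrystalIso.ε-pres iso i w a∼w)

single-column : ∀ {w} → w-v n ∼ w → ∃ λ C → w ≡ col C ∷ []
single-column here = _ , refl
single-column (fstep i path f) with single-column path
... | C , refl with map-just⁻ (fG i (col C)) (trans (sym (fW-single i (col C))) f)
...   | _ , fC , refl with fG-arrow i (col C) fC
...     | col _ = _ , refl
single-column (estep i path e) with single-column path
... | C , refl with map-just⁻ (eG i (col C)) e
...   | _ , eC , refl with eG-arrow i (col C) eC
...     | col _ = _ , refl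

-- Bumping

bar : Letter n → Letter n
bar (pos k) = neg k
bar zer     = zer
bar (neg k) = pos k

put : Letter n → SpinCol n → SpinCol n
put (pos k) C = C [ k ]≔ true
put zer     C = C
put (neg k) C = C [ k ]≔ false

-- x′𝔆′ with 𝔆′ = 𝔆 − x′ + x, where put x makes x a letter of the column in place of x̄ (no-op for 0).
bumped : SpinCol n → Letter n → Letter n → Word n
bumped C x y = letter y ⊗ col (put x (put (bar y) C))

-- Bumps C x y: y is the letter x′ of the statement.
data Bumps {n} (C : SpinCol n) : Letter n → Letter n → Set where
  pos-pos : ∀ {p s} → toℕ p ≤ toℕ s → lookup C s ≡ true →
            (∀ l → toℕ p ≤ toℕ l → toℕ l < toℕ s → lookup C l ≡ false) → Bumps C (pos p) (pos s)
  pos-zer : ∀ {p} → (∀ l → toℕ p ≤ toℕ l → lookup C l ≡ false) → Bumps C (pos p) zer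
  zer-neg : ∀ {t} → lookup C t ≡ false → (∀ l → toℕ t < toℕ l → lookup C l ≡ true) → Bumps C zer (neg t)
  neg-neg : ∀ {p t} → toℕ t ≤ toℕ p → lookup C t ≡ false →
            (∀ l → toℕ t < toℕ l → toℕ l ≤ toℕ p → lookup C l ≡ true) → Bumps C (neg p) (neg t)

pos-pos-self : ∀ {C : SpinCol n} {p} → lookup C p ≡ true → Bumps C (pos p) (pos p)
pos-pos-self Cp = pos-pos ℕ.≤-refl Cp (λ l p≤l l<p → ⊥-elim (ℕ.<⇒≱ l<p p≤l))

neg-neg-self : ∀ {C : SpinCol n} {p} → lookup C p ≡ false → Bumps C (neg p) (neg p)
neg-neg-self Cp = neg-neg ℕ.≤-refl Cp (λ l p<l l≤p → ⊥-elim (ℕ.<⇒≱ p<l l≤p))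

IsMin-unique : ∀ (S : Letter n → Set) {a b} → IsMin S a → IsMin S b → a ≡ b
IsMin-unique S {a} {b} (Sa , a-min) (Sb , b-min) = rank-injective a b (ℕ.≤-antisym (a-min b Sb) (b-min a Sa))

bumps⇒min : ∀ {C x y} → Bumps {n} C x y → IsMin (PrimeCand C x) y
bumps⇒min {C = C} (pos-pos {p} {s} p≤s Cs gap) = inj₁ (Cs , p≤s) , minimal
  where
  minimal : ∀ t → PrimeCand C (pos p) t → pos s ⪯ t
  minimal (pos l) (inj₁ (Cl , p≤l)) = ℕ.≮⇒≥ λ l<s → true≢false Cl (gap l p≤l l<s)
  minimal (neg l) _                = ℕ.<⇒≤ (rank-pos<neg s l)
  minimal zer     (inj₂ _)         = ℕ.<⇒≤ (toℕ<n s)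
bumps⇒min {C = C} (pos-zer {p} absent) = inj₂ (toℕ<n p , refl) , minimal
  where
  minimal : ∀ t → PrimeCand C (pos p) t → zer ⪯ t
  minimal (pos l) (inj₁ (Cl , p≤l)) = ⊥-elim (true≢false Cl (absent l p≤l))
  minimal zer     _                = ℕ.≤-refl
  minimal (neg l) _                = ℕ.<⇒≤ (rank-zer<neg l)
bumps⇒min {C = C} (zer-neg {t} Ct above) = inj₁ (Ct , ℕ.<⇒≤ (rank-zer<neg t)) , minimal
  where
  minimal : ∀ u → PrimeCand C zer u → neg t ⪯ u
  minimal (pos l) (inj₁ (_ , zer⪯l)) = ⊥-elim (ℕ.<⇒≱ (toℕ<n l) zer⪯l)
  minimal (neg l) (inj₁ (Cl , _))    = rank-neg-≤ l t (ℕ.≮⇒≥ λ t<l → true≢false (above l t<l) Cl)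
  minimal _       (inj₂ (zer≺zer , _)) = ⊥-elim (ℕ.<-irrefl refl zer≺zer)
bumps⇒min {C = C} (neg-neg {p} {t} t≤p Ct gap) = inj₁ (Ct , rank-neg-≤ t p t≤p) , minimal
  where
  minimal : ∀ u → PrimeCand C (neg p) u → neg t ⪯ u
  minimal (pos l) (inj₁ (_ , p⪯l))  = ⊥-elim (ℕ.<⇒≱ (rank-pos<neg l p) p⪯l)
  minimal (neg l) (inj₁ (Cl , p⪯l)) =
    rank-neg-≤ l t (ℕ.≮⇒≥ λ t<l → true≢false (gap l t<l (rank-neg-≤⁻ l p p⪯l)) Cl)
  minimal _       (inj₂ (p≺zer , _)) = ⊥-elim (ℕ.<-asym p≺zer (rank-zer<neg p))

bumps-unique : ∀ {C x y y′} → Bumps {n} C x y → Bumps C x y′ → y ≡ y′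
bumps-unique {C = C} {x} b b′ = IsMin-unique (PrimeCand C x) (bumps⇒min b) (bumps⇒min b′)

Transports : Fin n → SpinCol n → Letter n → SpinCol n → Letter n → Set
Transports i C₀ x₀ C x =
  ∀ {y₀} → Bumps C₀ x₀ y₀ → ∃ λ y → Bumps C x y × bumped C₀ x₀ y₀ ⟹[ i ] bumped C x y

transport-via : ∀ {i : Fin n} {C₀ x₀ C x y₀ y} → Bumps C₀ x₀ y₀ → Bumps C x y →
                bumped C₀ x₀ y₀ ⟹[ i ] bumped C x y → Transports i C₀ x₀ C x
transport-via {i = i} {C₀} {x₀} {C} {x} {y = y} b₀ b step b₀′ =
  y , b , subst (λ y₀ → bumped C₀ x₀ y₀ ⟹[ i ] bumped C x y) (bumps-unique b₀ b₀′) step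

transport-pos→pos : ∀ {C} → succF k ≡ just j → LastFalse C k → Transports k C (pos k) C (pos j)
transport-pos→pos {k = k} {j} {C} e (Ck , above) =
  transport-via (pos-pos (ℕ.<⇒≤ k<j) Cj gap) (pos-pos-self Cj) step
  where
  k<j = succF-< k e
  k≢j = succF-≢ k e
  Cj = above j k<j
  gap : ∀ l → toℕ k ≤ toℕ l → toℕ l < toℕ j → lookup C l ≡ false
  gap l k≤l l<j with l Fin.≟ k
  ... | yes refl = Ck
  ... | no l≢k   = ⊥-elim (no-between k e l (ℕ.≤∧≢⇒< k≤l (l≢k ∘ sym ∘ toℕ-injective)) l<j)
  step : bumped C (pos k) (pos j) ⟹[ k ] bumped C (pos j) (pos j)
  step = subst (bumped C (pos k) (pos j) ⟹[ k ]_)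
           (cong (λ D → letter (pos j) ⊗ col (D [ j ]≔ true))
                 ([]≔-revert (C [ j ]≔ false) k (trans (Vecₚ.lookup∘update′ k≢j C false) Ck)))
           (right-free (sink-pos (≢-sym k≢j))
                       (col (inner e (Vecₚ.lookup∘update k (C [ j ]≔ false) true)
                                     (lookup∘update²-first C (≢-sym k≢j)))))

transport-neg→neg : ∀ {C} → succF k ≡ just j → LastFalse C k → Transports k C (neg j) C (neg k)
transport-neg→neg {k = k} {j} {C} e (Ck , above) =
  transport-via (neg-neg (ℕ.<⇒≤ k<j) Ck (λ l k<l _ → above l k<l)) (neg-neg-self Ck) step
  where
  k<j = succF-< k e
  k≢j = succF-≢ k e
  Cj = above j k<j
  step : bumped C (neg j) (neg k) ⟹[ k ] bumped C (neg k) (neg k)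
  step = subst (bumped C (neg j) (neg k) ⟹[ k ]_)
           (cong (λ D → letter (neg k) ⊗ col D) (trans ([]≔²-revert C k≢j Ck Cj) (sym ([]≔-revert C k Ck))))
           (right-free (sink-neg (succF-irrefl k))
                       (col (inner e (lookup∘update²-first C k≢j)
                                     (Vecₚ.lookup∘update j (C [ k ]≔ true) false))))

transport-pos→zer : ∀ {C} → succF k ≡ nothing → LastFalse C k → Transports k C (pos k) C zer
transport-pos→zer {k = k} {C} e (Ck , _) =
  transport-via (pos-zer absent) (zer-neg Ck (λ l k<l → ⊥-elim (ℕ.<⇒≱ k<l (last-≤ k e l))))
                (left-free (source-present (Vecₚ.lookup∘update k C true)) (letter (zer→neg e)))
  where
  absent : ∀ l → toℕ k ≤ toℕ l → lookup C l ≡ false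
  absent l k≤l with toℕ-injective (ℕ.≤-antisym (last-≤ k e l) k≤l)
  ... | refl = Ck

transport-zer→neg : ∀ {C} → succF k ≡ nothing → LastFalse C k → Transports k C zer C (neg k)
transport-zer→neg {k = k} {C} e (Ck , above) =
  transport-via (zer-neg Ck above) (neg-neg-self Ck)
                (right-free (sink-neg (succF-nothing≢just e))
                            (col (last e (Vecₚ.lookup∘update k C true))))

module InnerColumnArrow {k j : Fin n} (e : succF k ≡ just j) {C₀ : SpinCol n}
       (C₀k : lookup C₀ k ≡ true) (C₀j : lookup C₀ j ≡ false)
       (above₀ : ∀ l → toℕ j < toℕ l → lookup C₀ l ≡ true) where

  C : SpinCol n
  C = C₀ [ k ]≔ false [ j ]≔ true

  k<j : toℕ k < toℕ j
  k<j = succF-< k e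

  k≢j : k ≢ j
  k≢j = succF-≢ k e

  Ck : lookup C k ≡ false
  Ck = lookup∘update²-first C₀ k≢j

  Cj : lookup C j ≡ true
  Cj = Vecₚ.lookup∘update j (C₀ [ k ]≔ false) true

  C-elsewhere : ∀ {l} → l ≢ k → l ≢ j → lookup C l ≡ lookup C₀ l
  C-elsewhere = lookup∘update²′ C₀

  next≤ : ∀ (l : Fin n) → toℕ k < toℕ l → toℕ j ≤ toℕ l
  next≤ l k<l = subst (_≤ toℕ l) (sym (succF-toℕ k e)) k<l

  C-above : ∀ (l : Fin n) → toℕ k < toℕ l → lookup C l ≡ true
  C-above l k<l with l Fin.≟ j
  ... | yes refl = Cj
  ... | no l≢j   = trans (C-elsewhere (>⇒≢ k<l) l≢j)
                         (above₀ l (ℕ.≤∧≢⇒< (next≤ l k<l) (≢-sym l≢j ∘ toℕ-injective)))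

  C[k]≔true : C [ k ]≔ true ≡ C₀ [ j ]≔ true
  C[k]≔true = begin
    C₀ [ k ]≔ false [ j ]≔ true [ k ]≔ true ≡⟨ Vecₚ.[]≔-commutes (C₀ [ k ]≔ false) j k (≢-sym k≢j) ⟩
    C₀ [ k ]≔ false [ k ]≔ true [ j ]≔ true ≡⟨ cong (_[ j ]≔ true) ([]≔-revert C₀ k C₀k) ⟩
    C₀ [ j ]≔ true                          ∎
    where open ≡-Reasoning

  transport-zer : Transports k C₀ zer C zer
  transport-zer =
    transport-via (zer-neg C₀j above₀) (zer-neg Ck C-above)
      (subst (λ D → bumped C₀ zer (neg j) ⟹[ k ] letter (neg k) ⊗ col D) (sym C[k]≔true)
             (left-free (source-present (trans (Vecₚ.lookup∘update′ k≢j C₀ true) C₀k))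
                        (letter (neg→neg e))))

  transport-neg : ∀ {p} → p ≢ k → Transports k C₀ (neg p) C (neg p)
  transport-neg {p} p≢k b₀@(neg-neg {t = t} t≤p C₀t gap) with ℕ.<-cmp (toℕ k) (toℕ p)
  ... | tri≈ _ k≡p _ = ⊥-elim (p≢k (sym (toℕ-injective k≡p)))
  ... | tri< k<p _ _ =
    transport-via (neg-neg (next≤ p k<p) C₀j (λ l j<l _ → above₀ l j<l))
                  (neg-neg (ℕ.<⇒≤ k<p) Ck (λ l k<l _ → C-above l k<l))
                  (subst (λ D → bumped C₀ (neg p) (neg j) ⟹[ k ] letter (neg k) ⊗ col D)
                         (cong (_[ p ]≔ false) (sym C[k]≔true))
                         (left-free (source-present D₀k) (letter (neg→neg e))))
                  b₀
    where
    D₀k : lookup (C₀ [ j ]≔ true [ p ]≔ false) k ≡ true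
    D₀k = trans (lookup∘update²′ C₀ k≢j (<⇒≢ k<p)) C₀k
  ... | tri> _ _ p<k = neg t , neg-neg t≤p Ct gap′ , subst (bumped C₀ (neg p) (neg t) ⟹[ k ]_) commute step
    where
    t<k = ℕ.≤-<-trans t≤p p<k
    k≢t = >⇒≢ t<k
    k≢p = >⇒≢ p<k
    j≢t = >⇒≢ (ℕ.<-trans t<k k<j)
    j≢p = >⇒≢ (ℕ.<-trans p<k k<j)
    Ct : lookup C t ≡ false
    Ct = trans (C-elsewhere (≢-sym k≢t) (≢-sym j≢t)) C₀t
    gap′ : ∀ l → toℕ t < toℕ l → toℕ l ≤ toℕ p → lookup C l ≡ true
    gap′ l t<l l≤p = trans (C-elsewhere (<⇒≢ l<k) (<⇒≢ (ℕ.<-trans l<k k<j))) (gap l t<l l≤p)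
      where l<k = ℕ.≤-<-trans l≤p p<k
    step : bumped C₀ (neg p) (neg t)
             ⟹[ k ] letter (neg t) ⊗ col (C₀ [ t ]≔ true [ p ]≔ false [ k ]≔ false [ j ]≔ true)
    step = right-free (sink-neg (j≢t ∘ just-injective ∘ trans (sym e)))
                      (col (inner e (trans (lookup∘update²′ C₀ k≢t k≢p) C₀k)
                                    (trans (lookup∘update²′ C₀ j≢t j≢p) C₀j)))
    commute : letter (neg t) ⊗ col (C₀ [ t ]≔ true [ p ]≔ false [ k ]≔ false [ j ]≔ true)
              ≡ bumped C (neg p) (neg t)
    commute = cong (λ D → letter (neg t) ⊗ col D) ([]≔²-commutes C₀ k≢t k≢p j≢t j≢p)

  transport-pos-k : ∀ {p} → p ≢ j → Bumps C₀ (pos p) (pos k) →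
                    ∃ λ y → Bumps C (pos p) y × bumped C₀ (pos p) (pos k) ⟹[ k ] bumped C (pos p) y
  transport-pos-k {p} p≢j (pos-pos p≤k _ gap) =
    pos j , pos-pos (ℕ.≤-trans p≤k (ℕ.<⇒≤ k<j)) Cj gap′ ,
    subst (bumped C₀ (pos p) (pos k) ⟹[ k ]_) restore (left-free (source-col e D₀j) (letter (pos→pos e)))
    where
    gap′ : ∀ l → toℕ p ≤ toℕ l → toℕ l < toℕ j → lookup C l ≡ false
    gap′ l p≤l l<j with l Fin.≟ k
    ... | yes refl = Ck
    ... | no l≢k   = trans (C-elsewhere l≢k (<⇒≢ l<j)) (gap l p≤l l<k)
      where l<k = ℕ.≤∧≢⇒< (inner-≤ k e l (ℕ.<⇒≤ l<j) (<⇒≢ l<j)) (l≢k ∘ toℕ-injective)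
    D₀j : lookup (C₀ [ k ]≔ false [ p ]≔ true) j ≡ false
    D₀j = trans (lookup∘update²′ C₀ (≢-sym k≢j) (≢-sym p≢j)) C₀j
    restore : letter (pos j) ⊗ col (C₀ [ k ]≔ false [ p ]≔ true) ≡ bumped C (pos p) (pos j)
    restore = cong (λ D → letter (pos j) ⊗ col (D [ p ]≔ true))
                   (sym ([]≔-revert (C₀ [ k ]≔ false) j
                                    (trans (Vecₚ.lookup∘update′ (≢-sym k≢j) C₀ false) C₀j)))

  transport-pos-s : ∀ {p s} → p ≢ j → s ≢ k → Bumps C₀ (pos p) (pos s) →
                    ∃ λ y → Bumps C (pos p) y × bumped C₀ (pos p) (pos s) ⟹[ k ] bumped C (pos p) y
  transport-pos-s {p} {s} p≢j s≢k (pos-pos p≤s C₀s gap) =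
    pos s , pos-pos p≤s (trans (C-elsewhere s≢k s≢j) C₀s) gap′ ,
    subst (bumped C₀ (pos p) (pos s) ⟹[ k ]_) commute step
    where
    k∉gap : toℕ p ≤ toℕ k → toℕ k < toℕ s → ⊥
    k∉gap p≤k k<s = true≢false C₀k (gap k p≤k k<s)
    s≢j : s ≢ j
    s≢j refl = true≢false C₀s C₀j
    p≢k : p ≢ k
    p≢k refl = k∉gap ℕ.≤-refl (ℕ.≤∧≢⇒< p≤s (s≢k ∘ sym ∘ toℕ-injective))
    gap′ : ∀ l → toℕ p ≤ toℕ l → toℕ l < toℕ s → lookup C l ≡ false
    gap′ l p≤l l<s = trans (C-elsewhere l≢k l≢j) (gap l p≤l l<s)
      where
      l≢k : l ≢ k
      l≢k refl = k∉gap p≤l l<s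
      l≢j : l ≢ j
      l≢j refl = k∉gap (inner-≤ k e p p≤l p≢j) (ℕ.<-trans k<j l<s)
    step : bumped C₀ (pos p) (pos s)
             ⟹[ k ] letter (pos s) ⊗ col (C₀ [ s ]≔ false [ p ]≔ true [ k ]≔ false [ j ]≔ true)
    step = right-free (sink-pos s≢k)
                      (col (inner e (trans (lookup∘update²′ C₀ (≢-sym s≢k) (≢-sym p≢k)) C₀k)
                                    (trans (lookup∘update²′ C₀ (≢-sym s≢j) (≢-sym p≢j)) C₀j)))
    commute : letter (pos s) ⊗ col (C₀ [ s ]≔ false [ p ]≔ true [ k ]≔ false [ j ]≔ true)
              ≡ bumped C (pos p) (pos s)
    commute = cong (λ D → letter (pos s) ⊗ col D)
                   ([]≔²-commutes C₀ (≢-sym s≢k) (≢-sym p≢k) (≢-sym s≢j) (≢-sym p≢j))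

  transport-pos : ∀ {p} → p ≢ j → Transports k C₀ (pos p) C (pos p)
  transport-pos {p} p≢j (pos-zer absent) with toℕ p ℕ.≤? toℕ k
  ... | yes p≤k = ⊥-elim (true≢false C₀k (absent k p≤k))
  ... | no  p≰k = ⊥-elim (true≢false (above₀ p j<p) (absent p ℕ.≤-refl))
    where j<p = ℕ.≤∧≢⇒< (next≤ p (ℕ.≰⇒> p≰k)) (p≢j ∘ sym ∘ toℕ-injective)
  transport-pos p≢j b₀@(pos-pos {s = s} _ _ _) with s Fin.≟ k
  ... | yes refl = transport-pos-k p≢j b₀
  ... | no s≢k   = transport-pos-s p≢j s≢k b₀

  transport-col : ∀ x → (∀ {y} → ¬ y ─[ k ]→ x) → Transports k C₀ x C x
  transport-col (pos p) source = transport-pos λ { refl → source (pos→pos e) }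
  transport-col zer     _      = transport-zer
  transport-col (neg p) source = transport-neg λ { refl → source (neg→neg e) }

module LastColumnArrow {k : Fin n} (e : succF k ≡ nothing) {C₀ : SpinCol n} (C₀k : lookup C₀ k ≡ true) where

  C : SpinCol n
  C = C₀ [ k ]≔ false

  below : ∀ {l} → toℕ l < toℕ k → lookup C l ≡ lookup C₀ l
  below l<k = Vecₚ.lookup∘update′ (<⇒≢ l<k) C₀ false

  sink-neg-last : ∀ {t} → Sink k (letter (neg t))
  sink-neg-last = sink-neg (succF-nothing≢just e)

  <k : ∀ {l} → l ≢ k → toℕ l < toℕ k
  <k {l} l≢k = ℕ.≤∧≢⇒< (last-≤ k e l) (l≢k ∘ toℕ-injective)

  transport-pos : ∀ {p} → Transports k C₀ (pos p) C (pos p)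
  transport-pos {p} (pos-zer absent) = ⊥-elim (true≢false C₀k (absent k (last-≤ k e p)))
  transport-pos {p} (pos-pos {s = s} p≤s C₀s gap) with s Fin.≟ k
  ... | yes refl = zer , pos-zer absent , left cond (letter (pos→zer e))
    where
    absent : ∀ l → toℕ p ≤ toℕ l → lookup C l ≡ false
    absent l p≤l with l Fin.≟ k
    ... | yes refl = Vecₚ.lookup∘update k C₀ false
    ... | no l≢k   = trans (below (<k l≢k)) (gap l p≤l (<k l≢k))
    cond : εG k (col (C₀ [ k ]≔ false [ p ]≔ true)) < φG k (letter (pos k))
    cond = subst (εG k (col (C₀ [ k ]≔ false [ p ]≔ true)) <_) (sym (φG-pos-last e)) (s≤s (εG-col≤1 k _))
  ... | no s≢k = pos s , pos-pos p≤s Cs gap′ , subst (bumped C₀ (pos p) (pos s) ⟹[ k ]_) commute step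
    where
    p<k = ℕ.≤-<-trans p≤s (<k s≢k)
    Cs : lookup C s ≡ true
    Cs = trans (below (<k s≢k)) C₀s
    gap′ : ∀ l → toℕ p ≤ toℕ l → toℕ l < toℕ s → lookup C l ≡ false
    gap′ l p≤l l<s = trans (below (ℕ.<-trans l<s (<k s≢k))) (gap l p≤l l<s)
    step : bumped C₀ (pos p) (pos s) ⟹[ k ] letter (pos s) ⊗ col (C₀ [ s ]≔ false [ p ]≔ true [ k ]≔ false)
    step = right-free (sink-pos s≢k) (col (last e (trans (lookup∘update²′ C₀ (≢-sym s≢k) (>⇒≢ p<k)) C₀k)))
    commute : letter (pos s) ⊗ col (C₀ [ s ]≔ false [ p ]≔ true [ k ]≔ false) ≡ bumped C (pos p) (pos s)
    commute = cong (λ D → letter (pos s) ⊗ col D) ([]≔²-commutes-[]≔ C₀ (≢-sym s≢k) (>⇒≢ p<k))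

  transport-neg : ∀ {p} → p ≢ k → Transports k C₀ (neg p) C (neg p)
  transport-neg {p} p≢k (neg-neg {t = t} t≤p C₀t gap) =
    neg t , neg-neg t≤p (trans (below t<k) C₀t) gap′ ,
    subst (bumped C₀ (neg p) (neg t) ⟹[ k ]_) commute step
    where
    p<k = <k p≢k
    t<k = ℕ.≤-<-trans t≤p p<k
    gap′ : ∀ l → toℕ t < toℕ l → toℕ l ≤ toℕ p → lookup C l ≡ true
    gap′ l t<l l≤p = trans (below (ℕ.≤-<-trans l≤p p<k)) (gap l t<l l≤p)
    step : bumped C₀ (neg p) (neg t) ⟹[ k ] letter (neg t) ⊗ col (C₀ [ t ]≔ true [ p ]≔ false [ k ]≔ false)
    step = right-free sink-neg-last (col (last e (trans (lookup∘update²′ C₀ (>⇒≢ t<k) (>⇒≢ p<k)) C₀k)))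
    commute : letter (neg t) ⊗ col (C₀ [ t ]≔ true [ p ]≔ false [ k ]≔ false) ≡ bumped C (neg p) (neg t)
    commute = cong (λ D → letter (neg t) ⊗ col D) ([]≔²-commutes-[]≔ C₀ (>⇒≢ t<k) (>⇒≢ p<k))

  transport-col : ∀ x → (∀ {y} → ¬ y ─[ k ]→ x) → Transports k C₀ x C x
  transport-col (pos p) _      = transport-pos
  transport-col zer     source = ⊥-elim (source (pos→zer e))
  transport-col (neg p) source = transport-neg λ { refl → source (zer→neg e) }

above-source : ∀ {C₀ : SpinCol n} (e : succF k ≡ just j) →
               (∀ l → toℕ k < toℕ l → lookup (C₀ [ k ]≔ false [ j ]≔ true) l ≡ true) →
               ∀ l → toℕ j < toℕ l → lookup C₀ l ≡ true
above-source {k = k} {C₀ = C₀} e above l j<l =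
  trans (sym (lookup∘update²′ C₀ (>⇒≢ k<l) (>⇒≢ j<l))) (above l k<l)
  where k<l = ℕ.<-trans (succF-< k e) j<l

transport-top : ∀ {C : SpinCol n} → succF i ≡ just j → AllTrue C → Transports i C (pos i) C (pos j)
transport-top {i = i} {j} {C} e all =
  transport-via (pos-pos-self (all i)) (pos-pos-self (all j))
    (subst (λ D → bumped C (pos i) (pos i) ⟹[ i ] letter (pos j) ⊗ col D)
           (trans ([]≔-revert C i (all i)) (sym ([]≔-revert C j (all j))))
           (left-free (source-present (Vecₚ.lookup∘update i (C [ i ]≔ false) true)) (letter (pos→pos e))))

transport : ∀ {C₀ x₀} {C : SpinCol (suc n)} {x} → LastFalse C i ⊎ AllTrue C → ¬ x ▵′ C →
            col C₀ ⊗ letter x₀ ⟹[ i ] col C ⊗ letter x → Transports i C₀ x₀ C x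
transport (inj₁ lastFalse) _ (right _ (letter (pos→pos e))) = transport-pos→pos e lastFalse
transport (inj₁ lastFalse) _ (right _ (letter (neg→neg e))) = transport-neg→neg e lastFalse
transport (inj₁ lastFalse) _ (right _ (letter (pos→zer e))) = transport-pos→zer e lastFalse
transport (inj₁ lastFalse) _ (right _ (letter (zer→neg e))) = transport-zer→neg e lastFalse
transport (inj₁ (_ , above)) _ (left {b = letter x} lt (col (inner {C = C₀} e C₀k C₀j))) =
  InnerColumnArrow.transport-col e C₀k C₀j (above-source {C₀ = C₀} e above) x
                                 (ε<φ⇒no-arrow-into {x = x} lt)
transport (inj₁ _) _ (left {b = letter x} lt (col (last e C₀k))) =
  LastColumnArrow.transport-col e C₀k x (ε<φ⇒no-arrow-into {x = x} lt)
transport (inj₂ all) _ (right _ (letter (pos→pos e))) = transport-top e all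
transport (inj₂ all) ¬▵′ (right _ (letter (neg→neg _))) = ⊥-elim (¬▵′ λ l _ → all l)
transport (inj₂ all) ¬▵′ (right _ (letter (pos→zer _))) = ⊥-elim (¬▵′ all)
transport (inj₂ all) ¬▵′ (right _ (letter (zer→neg _))) = ⊥-elim (¬▵′ λ l _ → all l)
transport {i = i} (inj₂ all) _ (left _ (col C₀⇒C)) = ⊥-elim (true≢false (all i) (arrow-target C₀⇒C))

w-1v-highest : ∀ (i : Fin (suc n)) → eW i (w-1v (suc n)) ≡ nothing
w-1v-highest {n} i with eW i (w-1v (suc n)) in e
... | nothing = refl
... | just _ with eW-⊗ i (letter (pos zero)) (col (topCol (suc n))) e
...   | left  _ (letter y→1)   = ⊥-elim (ℕ.n≮0 (arrow-rank y→1))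
...   | right _ (col C⇒top) = ⊥-elim (true≢false (topCol-allTrue i) (arrow-target C⇒top))

module _ {Ψ′ : Word (suc n) → Word (suc n)} (iso : CrystalIso (w-v1 (suc n)) (w-1v (suc n)) Ψ′) where
  open CrystalIso iso

  Ψ′-highest : Ψ′ (w-v1 (suc n)) ≡ w-1v (suc n)
  Ψ′-highest with surj (w-1v (suc n)) here
  ... | w , path , Ψ′w≡ with component-invariant ¬▵′-invariant (λ ()) path
  ...   | C , x , refl , ¬▵′ with descent C x
  ...     | highest (all , inj₁ refl) = ⊥-elim (¬▵′ all)
  ...     | highest (all , inj₂ refl) rewrite allTrue⇒topCol C all = Ψ′w≡
  ...     | step-from {i} _ step = case nothing≡just of λ ()
    where
    nothing≡just : nothing ≡ just (Ψ′ _)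
    nothing≡just = begin
      nothing                               ≡⟨ w-1v-highest i ⟨
      eW i (w-1v (suc n))                   ≡⟨ cong (eW i) Ψ′w≡ ⟨
      eW i (Ψ′ (col C ⊗ letter x))          ≡⟨ e-comm i _ path ⟩
      Maybe.map Ψ′ (eW i (col C ⊗ letter x)) ≡⟨ cong (Maybe.map Ψ′) (⟹-eW step) ⟩
      just (Ψ′ _)                           ∎
      where open ≡-Reasoning

  Ψ′-bumped : ∀ {C x} → ¬ x ▵′ C → ∃ λ y → Bumps C x y × Ψ′ (col C ⊗ letter x) ≡ bumped C x y
  Ψ′-bumped {C} {x} ¬▵′ = go C x ¬▵′ (<-wellFounded _)
    where
    go : ∀ C x → ¬ x ▵′ C → Acc _<_ (μ (col C ⊗ letter x)) →
         ∃ λ y → Bumps C x y × Ψ′ (col C ⊗ letter x) ≡ bumped C x y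
    go C x ¬▵′ (acc smaller) with descent C x
    ... | highest (all , inj₁ refl) = ⊥-elim (¬▵′ all)
    ... | highest (all , inj₂ refl) rewrite allTrue⇒topCol C all =
      pos zero , pos-pos-self {C = topCol (suc n)} refl ,
      trans Ψ′-highest (cong (λ D → letter (pos zero) ⊗ col D)
                             (sym ([]≔-revert (topCol (suc n)) zero {y = false} refl)))
    ... | step-from {i} {C₀} {x₀} reason step
      with proj₂ (¬▵′-invariant step) ¬▵′
    ... | ¬▵′₀ with go C₀ x₀ ¬▵′₀ (smaller (⟹-μ step))
    ...   | y₀ , b₀ , Ψ′≡ with transport reason ¬▵′ step b₀
    ...     | y , b , step′ = y , b , just-injective (begin
      just (Ψ′ (col C ⊗ letter x))              ≡⟨ cong (Maybe.map Ψ′) (⟹-fW step) ⟨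
      Maybe.map Ψ′ (fW i (col C₀ ⊗ letter x₀))  ≡⟨ f-comm i _ (reach-¬▵′ ¬▵′₀) ⟨
      fW i (Ψ′ (col C₀ ⊗ letter x₀))            ≡⟨ cong (fW i) Ψ′≡ ⟩
      fW i (bumped C₀ x₀ y₀)                    ≡⟨ ⟹-fW step′ ⟩
      just (bumped C x y)                       ∎)
      where open ≡-Reasoning

vertices-v⊗0 : ∀ w → (w-v0 (suc n) ∼ w → ∃₂ λ C x → w ≡ col C ∷ letter x ∷ [] × x ▵ C)
                   × ((∃₂ λ C x → w ≡ col C ∷ letter x ∷ [] × x ▵ C) → w-v0 (suc n) ∼ w)
vertices-v⊗0 {n} w = into , λ { (C , x , refl , ▵) → reach-▵′ (▵⇒▵′ C x ▵) }
  where
  into : w-v0 (suc n) ∼ w → ∃₂ λ C x → w ≡ col C ∷ letter x ∷ [] × x ▵ C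
  into path with component-invariant ▵′-invariant (topCol-allTrue {suc n}) path
  ... | C , x , w≡ , ▵′ = C , x , w≡ , ▵′⇒▵ C x ▵′

vertices-v⊗1 : ∀ w → (w-v1 (suc n) ∼ w → ∃₂ λ C x → w ≡ col C ∷ letter x ∷ [] × ¬ (x ▵ C))
                   × ((∃₂ λ C x → w ≡ col C ∷ letter x ∷ [] × ¬ (x ▵ C)) → w-v1 (suc n) ∼ w)
vertices-v⊗1 {n} w = into , λ { (C , x , refl , ¬▵) → reach-¬▵′ (¬▵ ∘ ▵′⇒▵ C x) }
  where
  into : w-v1 (suc n) ∼ w → ∃₂ λ C x → w ≡ col C ∷ letter x ∷ [] × ¬ (x ▵ C)
  into path with component-invariant ¬▵′-invariant (λ ()) path
  ... | C , x , w≡ , ¬▵′ = C , x , w≡ , ¬▵′ ∘ ▵⇒▵′ C x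

Ψ-on-v⊗0 : ∀ Ψ → CrystalIso (w-v0 (suc n)) (w-v (suc n)) Ψ → ∀ C x → x ▵ C →
           ∃ λ C′ → (∀ i → wtG (col C′) i ≡ wtG (col C) i + wtG (letter x) i)
                  × Ψ (col C ∷ letter x ∷ []) ≡ col C′ ∷ []
Ψ-on-v⊗0 Ψ iso C x ▵ = proj₁ image , weight , proj₂ image
  where
  path = reach-▵′ (▵⇒▵′ C x ▵)
  image = single-column (CrystalIso.into iso _ path)
  weight : ∀ i → wtG (col (proj₁ image)) i ≡ wtG (col C) i + wtG (letter x) i
  weight i = begin
    wtG (col (proj₁ image)) i        ≡⟨ wtW-single i (col (proj₁ image)) ⟨
    wtW i (col (proj₁ image) ∷ [])   ≡⟨ cong (wtW i) (proj₂ image) ⟨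
    wtW i (Ψ (col C ⊗ letter x))     ≡⟨ iso-wtW iso i path ⟩
    wtW i (col C ⊗ letter x)         ≡⟨ wtW-⊗ i (col C) (letter x) ⟩
    wtG (col C) i + wtG (letter x) i ∎
    where open ≡-Reasoning

Ψ′-on-v⊗1 : ∀ Ψ′ → CrystalIso (w-v1 (suc n)) (w-1v (suc n)) Ψ′ →
            ∀ C x → ¬ (x ▵ C) → ∀ x′ → IsMin (PrimeCand C x) x′ →
            ∃ λ C′ → (∀ i → wtG (col C′) i ≡ (wtG (col C) i + wtG (letter x) i) - wtG (letter x′) i)
                   × Ψ′ (col C ∷ letter x ∷ []) ≡ letter x′ ∷ col C′ ∷ []
Ψ′-on-v⊗1 Ψ′ iso C x ¬▵ x′ x′-min with Ψ′-bumped iso (¬▵ ∘ ▵′⇒▵ C x)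
... | y , b , Ψ′≡ with IsMin-unique (PrimeCand C x) (bumps⇒min b) x′-min
... | refl = C′ , (λ i → m+n≡o⇒n≡o-m (weight i)) , Ψ′≡
  where
  C′ = put x (put (bar y) C)
  weight : ∀ i → wtG (letter y) i + wtG (col C′) i ≡ wtG (col C) i + wtG (letter x) i
  weight i = begin
    wtG (letter y) i + wtG (col C′) i ≡⟨ wtW-⊗ i (letter y) (col C′) ⟨
    wtW i (letter y ⊗ col C′)         ≡⟨ cong (wtW i) Ψ′≡ ⟨
    wtW i (Ψ′ (col C ⊗ letter x))     ≡⟨ iso-wtW iso i (reach-¬▵′ (¬▵ ∘ ▵′⇒▵ C x)) ⟩
    wtW i (col C ⊗ letter x)          ≡⟨ wtW-⊗ i (col C) (letter x) ⟩
    wtG (col C) i + wtG (letter x) i  ∎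
    where open ≡-Reasoning

lemma4p2p4 : (n : ℕ) → {{nz : NonZero n}} →
    -- (1) vertices of B(v_{Λn} ⊗ 0)
    (∀ w → (w-v0 n ∼ w → ∃₂ λ C x → w ≡ col C ∷ letter x ∷ [] × x ▵ C)
         × ((∃₂ λ C x → w ≡ col C ∷ letter x ∷ [] × x ▵ C) → w-v0 n ∼ w))
    -- (2) vertices of B(v_{Λn} ⊗ 1)
    × (∀ w → (w-v1 n ∼ w → ∃₂ λ C x → w ≡ col C ∷ letter x ∷ [] × ¬ (x ▵ C))
         × ((∃₂ λ C x → w ≡ col C ∷ letter x ∷ [] × ¬ (x ▵ C)) → w-v1 n ∼ w))
    -- (3) the isomorphism Ψ : B(v_{Λn} ⊗ 0) → B(v_{Λn})
    × (∀ Ψ → CrystalIso (w-v0 n) (w-v n) Ψ →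
         ∀ C x → x ▵ C →
         ∃ λ C' → (∀ i → wtG (col C') i ≡ wtG (col C) i + wtG (letter x) i)
                × Ψ (col C ∷ letter x ∷ []) ≡ col C' ∷ [])
    -- (3) the isomorphism Ψ' : B(v_{Λn} ⊗ 1) → B(1 ⊗ v_{Λn})
    × (∀ Ψ' → CrystalIso (w-v1 n) (w-1v n) Ψ' →
         ∀ C x → ¬ (x ▵ C) → ∀ x' → IsMin (PrimeCand C x) x' →
         ∃ λ C' → (∀ i → wtG (col C') i ≡ (wtG (col C) i + wtG (letter x) i) - wtG (letter x') i)
                × Ψ' (col C ∷ letter x ∷ []) ≡ letter x' ∷ col C' ∷ [])
lemma4p2p4 (suc n) = vertices-v⊗0 , vertices-v⊗1 , Ψ-on-v⊗0 , Ψ′-on-v⊗1
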